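{- For $f=f_{\overline{\mathbb Q}}$ and all $a,b\in\mathbb F_{\hat p}$: $f(a+b)\le f(a)f(b)+1$, $f(ab)\le f(a)f(b)$, $f(-a)=f(a)$, and if $a\ne0$ then $f(a^{ -1})\le2f(a)^2+f(a)$. Furthermore, if $P(x)=x^{\hat n}+\sum_{i=0}^{\hat n-1}a_ix^i$ is an internal monic polynomial over $\mathbb F_{\hat p}$ of degree $\hat n\in{}^*\mathbb N$, $\hat n\ge1$, then every root $x\in\mathbb F_{\hat p}$ of $P$ satisfies $f(x)\le\hat n\prod_{i=0}^{\hat n-1}f(a_i)$ (the product taken internally).
   Context: ${}^*\mathbb N=\mathbb N^I/\mathcal F$ is an ultrapower of $\mathbb N$ by a countably incomplete ultrafilter; internal objects are elements of ${}^*A$ for $A$ in the superstructure over $\mathbb N$, with $*$ the elementary embedding induced by the ultrapower. $\hat p\in{}^*\mathbb N\setminus\mathbb N$ is a nonstandard prime and $\mathbb F_{\hat p}=\{\hat n:\hat n<\hat p\}$ with operations modulo $\hat p$. For $a\in\mathbb F_{\hat p}$ let $|a|=\min(a,\hat p-a)$. The internal function $f_{\overline{\mathbb Q}}:\mathbb F_{\hat p}\to{}^*\mathbb N$ sends $x$ to the minimum of $n+\lceil\log_2\max(m,k)\rceil$ over all $n,m,k\in{}^*\mathbb N$ with $n\ge1$, $k\ne0$ in $\mathbb F_{\hat p}$, such that $kx$ is an eigenvalue of some internal $n\times n$ matrix over $\mathbb F_{\hat p}$ all of whose entries have absolute value at most $m$. -}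

module Defs where

open import Data.Nat using (ℕ; zero; suc; _+_; _*_; _∸_; _≤_; _<_; _⊔_; _⊓_; _%_)
open import Data.Nat.Logarithm using (⌈log₂_⌉)
open import Data.Nat.Primality using (Prime)
open import Data.Fin using (Fin)
import Data.Fin as Fin
open import Data.Product using (Σ; ∃; _×_)
open import Relation.Binary.PropositionalEquality using (_≡_; _≢_)
open import Relation.Nullary using (¬_)
open import Data.Unit using (⊤)
open import Data.Empty using (⊥)
open import Data.Sum using (_⊎_)

-- Standard level: the prime field F_p, elements represented by ℕ < p.

-- reduction mod p (total; mod 0 is the identity, never used for primes)
_mod_ : ℕ → ℕ → ℕ
x mod zero    = x
x mod (suc n) = x % suc n

addF : ℕ → ℕ → ℕ → ℕ
addF p a b = (a + b) mod p

mulF : ℕ → ℕ → ℕ → ℕ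
mulF p a b = (a * b) mod p

negF : ℕ → ℕ → ℕ
negF p a = (p ∸ a) mod p

absF : ℕ → ℕ → ℕ
absF p a = a ⊓ (p ∸ a)

∑ : (n : ℕ) → (Fin n → ℕ) → ℕ
∑ zero    f = 0
∑ (suc n) f = f Fin.zero + ∑ n (λ j → f (Fin.suc j))

∏ : (n : ℕ) → (Fin n → ℕ) → ℕ
∏ zero    f = 1
∏ (suc n) f = f Fin.zero * ∏ n (λ j → f (Fin.suc j))

IsEigenvalue : (p n : ℕ) → (Fin n → Fin n → ℕ) → ℕ → Set
IsEigenvalue p n M λ' =
  Σ (Fin n → ℕ) λ v →
    (∀ j → v j < p) ×
    (¬ (∀ j → v j ≡ 0)) ×
    (∀ r → (∑ n (λ c → M r c * v c)) mod p ≡ (λ' * v r) mod p)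

-- c is one of the values n + ⌈log₂ max(m,k)⌉ in the definition of f_{Q̄}(x)
Achieves : (p x c : ℕ) → Set
Achieves p x c =
  Σ ℕ λ n → Σ ℕ λ m → Σ ℕ λ k →
    (1 ≤ n) × ((k mod p) ≢ 0) ×
    (Σ (Fin n → Fin n → ℕ) λ M →
        (∀ r s → (M r s < p) × (absF p (M r s) ≤ m)) ×
        IsEigenvalue p n M ((k * x) mod p)) ×
    (c ≡ n + ⌈log₂ (m ⊔ k) ⌉)

IsF : (p x c : ℕ) → Set
IsF p x c = Achieves p x c × (∀ c' → Achieves p x c' → c ≤ c')

evalMonic : (p n : ℕ) → (Fin n → ℕ) → ℕ → ℕ
evalMonic p n a x = (x Data.Nat.^ n + ∑ n (λ j → a j * x Data.Nat.^ Fin.toℕ j)) mod p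

record Ultrafilter (I : Set) : Set₁ where
  field
    _∈𝓕    : (I → Set) → Set
    whole   : (λ _ → ⊤) ∈𝓕
    empty∉  : ¬ ((λ _ → ⊥) ∈𝓕)
    upward  : ∀ {A B : I → Set} → (∀ i → A i → B i) → A ∈𝓕 → B ∈𝓕
    inter   : ∀ {A B : I → Set} → A ∈𝓕 → B ∈𝓕 → (λ i → A i × B i) ∈𝓕
    ultra   : ∀ (A : I → Set) → (A ∈𝓕) ⊎ ((λ i → ¬ A i) ∈𝓕)
    countablyIncomplete :
      Σ (ℕ → I → Set) λ X → (∀ n → X n ∈𝓕) × (∀ i → ¬ (∀ n → X n i))

module Ultrapower {I : Set} (U : Ultrafilter I) where
  open Ultrafilter U

  -- "for 𝓕-almost all i"; internal (in)equalities in *ℕ are of this form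
  AE : (I → Set) → Set
  AE P = P ∈𝓕

  NonstandardPrime : (I → ℕ) → Set
  NonstandardPrime p = AE (λ i → Prime (p i)) × (∀ N → ¬ AE (λ i → p i ≡ N))

  InF : (I → ℕ) → (I → ℕ) → Set
  InF p a = AE (λ i → a i < p i)

  IsF̂ : (p x c : I → ℕ) → Set
  IsF̂ p x c = AE (λ i → IsF (p i) (x i) (c i))

  AddBound : (I → ℕ) → Set
  AddBound p = ∀ (a b fa fb fs : I → ℕ) → InF p a → InF p b →
    IsF̂ p a fa → IsF̂ p b fb → IsF̂ p (λ i → addF (p i) (a i) (b i)) fs →
    AE (λ i → fs i ≤ fa i * fb i + 1)

  MulBound : (I → ℕ) → Set
  MulBound p = ∀ (a b fa fb fm : I → ℕ) → InF p a → InF p b →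
    IsF̂ p a fa → IsF̂ p b fb → IsF̂ p (λ i → mulF (p i) (a i) (b i)) fm →
    AE (λ i → fm i ≤ fa i * fb i)

  NegEq : (I → ℕ) → Set
  NegEq p = ∀ (a fa fn : I → ℕ) → InF p a →
    IsF̂ p a fa → IsF̂ p (λ i → negF (p i) (a i)) fn →
    AE (λ i → fn i ≡ fa i)

  InvBound : (I → ℕ) → Set
  InvBound p = ∀ (a b fa fb : I → ℕ) → InF p a → InF p b →
    ¬ AE (λ i → a i ≡ 0) → AE (λ i → mulF (p i) (a i) (b i) ≡ 1) →
    IsF̂ p a fa → IsF̂ p b fb →
    AE (λ i → fb i ≤ 2 * (fa i * fa i) + fa i)

  RootBound : (I → ℕ) → Set
  RootBound p = ∀ (n : I → ℕ) (a fa : (i : I) → Fin (n i) → ℕ) (x fx : I → ℕ) →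
    AE (λ i → 1 ≤ n i) →
    AE (λ i → ∀ j → a i j < p i) →
    AE (λ i → ∀ j → IsF (p i) (a i j) (fa i j)) →
    InF p x →
    AE (λ i → evalMonic (p i) (n i) (a i) (x i) ≡ 0) →
    IsF̂ p x fx →
    AE (λ i → fx i ≤ n i * ∏ (n i) (fa i))

module Submission where

-- A certificate for x ∈ 𝔽ₚ is an integer n × n matrix M with entries bounded by m, a scale k ≢ 0 and a
-- vector v ≢ 0 with M v ≡ k x v (mod p); its size n + ⌈log₂ (m ⊔ k)⌉ is one of the values minimised by f,
-- so f x is at most the size of any certificate for x. Certificates compose like algebraic numbers.
-- Negating M certifies −a, and Kronecker products certify ab. Tensoring with scalar matrices turns
-- certificates of a₀, …, a_N into matrices with one common eigenvector; their sum certifies a₀ + a₁, and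
-- their block companion matrix certifies any root of x^{N+1} + Σ a_j x^j. For a⁻¹, the eigenvalue ka of
-- M is a root of its characteristic polynomial, whose integer coefficients are at most n^n 2^n (m ⊔ 1)^n;
-- reversed and cut at its lowest coefficient c_j ≢ 0 it has (ka)⁻¹ as a root, and its companion matrix
-- scaled by k certifies a⁻¹ = k (ka)⁻¹. Every bound holds at each standard prime, hence componentwise
-- in the ultrapower.

open import Defs
open import Data.Nat using (ℕ)
open import Data.Product using (_×_)

open import Data.Empty using (⊥-elim)
open import Data.Fin.Base as Fin using (Fin; zero; suc; toℕ; punchIn; fromℕ<; inject₁; combine; quotient; remainder; _↑ˡ_; _↑ʳ_)
import Data.Fin.Properties as Fin
open import Data.Integer.Base as ℤ using (ℤ; +_; -_; _+_; _*_; _-_; ∣_∣; 0ℤ; 1ℤ; _^_; +[1+_]; -[1+_])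
open import Data.Integer.DivMod using (n%ℕd<d; a≡a%ℕn+[a/ℕn]*n)
import Data.Integer.Properties as ℤ
open import Data.Integer.Tactic.RingSolver using (solve-∀)
open import Data.Nat.Base as ℕ using (zero; suc; _≤_; _<_; _⊔_; z≤n; s≤s; NonZero)
open import Data.Nat.Coprimality using (prime⇒coprime; coprime-Bézout)
open import Data.Nat.Divisibility using (_∣_; divides; ∣1⇒≡1)
open import Data.Nat.DivMod using (m≡m%n+[m/n]*n; [m+kn]%n≡m%n; m<n⇒m%n≡m; m%n<n; m%n≤m)
open import Data.Nat.GCD using (module Bézout)
open import Data.Nat.Induction using (<-rec)
open import Data.Nat.Logarithm using (⌈log₂_⌉; ⌈log₂⌉-mono-≤; ⌈log₂2^n⌉≡n; ⌈log₂⌈n/2⌉⌉≡⌈log₂n⌉∸1)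
open import Data.Nat.Primality using (Prime; euclidsLemma; prime⇒nonZero; ¬prime[1])
import Data.Nat.Properties as ℕ
open import Data.Nat.Tactic.RingSolver using () renaming (solve-∀ to solve-∀ℕ)
open import Data.Product as Σ using (Σ; _,_)
open import Data.Sum as Sum using (_⊎_)
open import Data.Vec.Functional using (Vector; []; _∷_; updateAt; removeAt)
open import Data.Vec.Functional.Properties using (updateAt-updates; updateAt-minimal; updateAt-id-local)
open import Function.Base using (_∘_; const; flip)
open import Relation.Binary.Bundles using (Setoid)
open import Relation.Binary.Definitions using (Tri; tri<; tri≈; tri>; DecidableEquality)
open import Relation.Binary.PropositionalEquality
import Relation.Binary.Reasoning.Setoid as ≈-Reasoning
open import Relation.Nullary using (¬_; Dec; yes; no)
open import Algebra.Properties.Semiring.Sum ℤ.+-*-semiring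
  using (sum; sum-syntax; sum-cong-≗; sum-replicate-zero; sum-init-last; ∑-distrib-+; ∑-comm; *-distribˡ-sum; *-distribʳ-sum)
open import Algebra.Properties.CommutativeSemigroup ℤ.*-commutativeSemigroup
  using () renaming (interchange to *-interchange; x∙yz≈y∙xz to *-left-comm)
open import Algebra.Properties.CommutativeMonoid.Sum ℤ.*-1-commutativeMonoid
  using () renaming (sum to product; sum-cong-≗ to product-cong-≗; sum-remove to product-remove)

-- Finite sums over ℤ

∑-neg : ∀ {n} (f : Vector ℤ n) → ∑[ i < n ] (- f i) ≡ - sum f
∑-neg {zero}  f = refl
∑-neg {suc n} f = trans (cong (_+_ (- f zero)) (∑-neg (f ∘ suc))) (sym (ℤ.neg-distrib-+ (f zero) _))

∑-zero : ∀ {n} (f : Vector ℤ n) → (∀ i → f i ≡ 0ℤ) → sum f ≡ 0ℤ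
∑-zero {n} f f≡0 = trans (sum-cong-≗ f≡0) (sum-replicate-zero n)

∑-++ : ∀ m n (f : Vector ℤ (m ℕ.+ n)) → sum f ≡ ∑[ i < m ] f (i ↑ˡ n) + ∑[ j < n ] f (m ↑ʳ j)
∑-++ zero    n f = sym (ℤ.+-identityˡ _)
∑-++ (suc m) n f = trans (cong (_+_ (f zero)) (∑-++ m n (f ∘ suc))) (sym (ℤ.+-assoc (f zero) _ _))

∑-combine : ∀ m n (f : Vector ℤ (m ℕ.* n)) → sum f ≡ ∑[ i < m ] ∑[ j < n ] f (combine i j)
∑-combine zero    n f = refl
∑-combine (suc m) n f = trans (∑-++ n (m ℕ.* n) f) (cong (_+_ (∑[ j < n ] f (j ↑ˡ (m ℕ.* n)))) (∑-combine m n (f ∘ (n ↑ʳ_))))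

∑-single : ∀ {n} (f : Vector ℤ n) c → (∀ i → i ≢ c → f i ≡ 0ℤ) → sum f ≡ f c
∑-single {suc n} f zero    off = trans (cong (_+_ (f zero)) (∑-zero (f ∘ suc) (λ i → off (suc i) (λ ())))) (ℤ.+-identityʳ _)
∑-single {suc n} f (suc c) off = trans (cong (_+ sum (f ∘ suc)) (off zero (λ ())))
  (trans (ℤ.+-identityˡ _) (∑-single (f ∘ suc) c (λ i i≢c → off (suc i) (i≢c ∘ Fin.suc-injective))))

∣∑∣≤ : ∀ {n} (f : Vector ℤ n) b → (∀ i → ∣ f i ∣ ≤ b) → ∣ sum f ∣ ≤ n ℕ.* b
∣∑∣≤ {zero}  f b f≤b = z≤n
∣∑∣≤ {suc n} f b f≤b = ℕ.≤-trans (ℤ.∣i+j∣≤∣i∣+∣j∣ (f zero) _) (ℕ.+-mono-≤ (f≤b zero) (∣∑∣≤ (f ∘ suc) b (f≤b ∘ suc)))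

module KroneckerDelta {A : Set} (_≟_ : DecidableEquality A) where

  δ : A → A → ℤ
  δ i j with i ≟ j
  ... | yes _ = 1ℤ
  ... | no  _ = 0ℤ

  δ-diag : ∀ i → δ i i ≡ 1ℤ
  δ-diag i with i ≟ i
  ... | yes _  = refl
  ... | no i≢i = ⊥-elim (i≢i refl)

  δ-off : ∀ {i j} → i ≢ j → δ i j ≡ 0ℤ
  δ-off {i} {j} i≢j with i ≟ j
  ... | yes i≡j = ⊥-elim (i≢j i≡j)
  ... | no  _   = refl

  δ-off-* : ∀ {i j} → i ≢ j → ∀ z → δ i j * z ≡ 0ℤ
  δ-off-* i≢j z = trans (cong (_* z) (δ-off i≢j)) (ℤ.*-zeroˡ z)

  δ-sym : ∀ i j → δ i j ≡ δ j i
  δ-sym i j with i ≟ j | j ≟ i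
  ... | yes _   | yes _   = refl
  ... | no  _   | no  _   = refl
  ... | yes i≡j | no  j≢i = ⊥-elim (j≢i (sym i≡j))
  ... | no  i≢j | yes j≡i = ⊥-elim (i≢j (sym j≡i))

  ∣δ∣≤1 : ∀ i j → ∣ δ i j ∣ ≤ 1
  ∣δ∣≤1 i j with i ≟ j
  ... | yes _ = ℕ.≤-refl
  ... | no  _ = z≤n

open module FinDelta {n} = KroneckerDelta (Fin._≟_ {n})
open KroneckerDelta ℕ._≟_ using () renaming (δ to δℕ; δ-diag to δℕ-diag; δ-off-* to δℕ-off-*; ∣δ∣≤1 to ∣δℕ∣≤1)

∑-δ : ∀ {n} (f : Vector ℤ n) i → ∑[ j < n ] (δ j i * f j) ≡ f i
∑-δ f i = trans (∑-single _ i (λ j j≢i → δ-off-* j≢i (f j)))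
                (trans (cong (_* f i) (δ-diag i)) (ℤ.*-identityˡ (f i)))

-- Numerical estimates

n≤2^⌈log₂n⌉ : ∀ n → n ≤ 2 ℕ.^ ⌈log₂ n ⌉
n≤2^⌈log₂n⌉ = <-rec _ go
  where
  go : ∀ n → (∀ {m} → m < n → m ≤ 2 ℕ.^ ⌈log₂ m ⌉) → n ≤ 2 ℕ.^ ⌈log₂ n ⌉
  go zero          _  = z≤n
  go (suc zero)    _  = s≤s z≤n
  go n@(suc (suc k)) ih = begin
    n                                        ≡⟨ ℕ.⌊n/2⌋+⌈n/2⌉≡n n ⟨
    ℕ.⌊ n /2⌋ ℕ.+ h                          ≤⟨ ℕ.+-monoˡ-≤ h (ℕ.⌊n/2⌋≤⌈n/2⌉ n) ⟩
    h ℕ.+ h                                  ≤⟨ ℕ.+-mono-≤ h≤ h≤ ⟩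
    2 ℕ.^ (L ℕ.∸ 1) ℕ.+ 2 ℕ.^ (L ℕ.∸ 1)      ≡⟨ cong (ℕ._+_ (2 ℕ.^ (L ℕ.∸ 1))) (ℕ.+-identityʳ _) ⟨
    2 ℕ.^ suc (L ℕ.∸ 1)                      ≡⟨ cong (2 ℕ.^_) (ℕ.m+[n∸m]≡n (⌈log₂⌉-mono-≤ {2} {n} (s≤s (s≤s z≤n)))) ⟩
    2 ℕ.^ L                                  ∎
    where
    open ℕ.≤-Reasoning
    h = ℕ.⌈ n /2⌉
    L = ⌈log₂ n ⌉
    h≤ : h ≤ 2 ℕ.^ (L ℕ.∸ 1)
    h≤ = subst (λ e → h ≤ 2 ℕ.^ e) (⌈log₂⌈n/2⌉⌉≡⌈log₂n⌉∸1 n) (ih (ℕ.⌈n/2⌉<n k))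

n≤2^e⇒⌈log₂n⌉≤e : ∀ {n} e → n ≤ 2 ℕ.^ e → ⌈log₂ n ⌉ ≤ e
n≤2^e⇒⌈log₂n⌉≤e e n≤2^e = ℕ.≤-trans (⌈log₂⌉-mono-≤ n≤2^e) (ℕ.≤-reflexive (⌈log₂2^n⌉≡n e))

n≤2^n : ∀ n → n ≤ 2 ℕ.^ n
n≤2^n zero    = z≤n
n≤2^n (suc n) = ℕ.≤-trans (ℕ.+-mono-≤ (ℕ.m^n>0 2 n) (n≤2^n n)) (ℕ.≤-reflexive (cong (ℕ._+_ (2 ℕ.^ n)) (sym (ℕ.+-identityʳ _))))

⊔≤2^⌈log₂⊔⌉ : ∀ m n → m ≤ 2 ℕ.^ ⌈log₂ (m ⊔ n) ⌉ × n ≤ 2 ℕ.^ ⌈log₂ (m ⊔ n) ⌉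
⊔≤2^⌈log₂⊔⌉ m n = ℕ.≤-trans (ℕ.m≤m⊔n m n) (n≤2^⌈log₂n⌉ (m ⊔ n)) , ℕ.≤-trans (ℕ.m≤n⊔m m n) (n≤2^⌈log₂n⌉ (m ⊔ n))

m*n+[k+l]≤[m+k]*[n+l] : ∀ {m n} k l → 1 ≤ m → 1 ≤ n → m ℕ.* n ℕ.+ (k ℕ.+ l) ≤ (m ℕ.+ k) ℕ.* (n ℕ.+ l)
m*n+[k+l]≤[m+k]*[n+l] {m} {n} k l 1≤m 1≤n = begin
  m ℕ.* n ℕ.+ (k ℕ.+ l)                           ≤⟨ ℕ.+-monoʳ-≤ (m ℕ.* n) (ℕ.+-mono-≤ (ℕ.m≤m*n k n {{ℕ.>-nonZero 1≤n}}) (ℕ.m≤n*m l m {{ℕ.>-nonZero 1≤m}})) ⟩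
  m ℕ.* n ℕ.+ (k ℕ.* n ℕ.+ m ℕ.* l)               ≤⟨ ℕ.m≤m+n _ (k ℕ.* l) ⟩
  m ℕ.* n ℕ.+ (k ℕ.* n ℕ.+ m ℕ.* l) ℕ.+ k ℕ.* l   ≡⟨ expand m n k l ⟩
  (m ℕ.+ k) ℕ.* (n ℕ.+ l)                         ∎
  where
  open ℕ.≤-Reasoning
  expand : ∀ m n k l → m ℕ.* n ℕ.+ (k ℕ.* n ℕ.+ m ℕ.* l) ℕ.+ k ℕ.* l ≡ (m ℕ.+ k) ℕ.* (n ℕ.+ l)
  expand = solve-∀ℕ

quadratic-size-bound : ∀ n L → 1 ≤ n → n ℕ.+ (L ℕ.+ (n ℕ.* n ℕ.+ (n ℕ.+ L ℕ.* n))) ≤ 2 ℕ.* ((n ℕ.+ L) ℕ.* (n ℕ.+ L)) ℕ.+ (n ℕ.+ L)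
quadratic-size-bound n L 1≤n = begin
  n ℕ.+ (L ℕ.+ (n ℕ.* n ℕ.+ (n ℕ.+ L ℕ.* n)))
    ≤⟨ ℕ.+-monoˡ-≤ _ (ℕ.m≤m*n n n {{ℕ.>-nonZero 1≤n}}) ⟩
  n ℕ.* n ℕ.+ (L ℕ.+ (n ℕ.* n ℕ.+ (n ℕ.+ L ℕ.* n)))
    ≤⟨ ℕ.m≤m+n _ (3 ℕ.* (n ℕ.* L) ℕ.+ 2 ℕ.* (L ℕ.* L)) ⟩
  n ℕ.* n ℕ.+ (L ℕ.+ (n ℕ.* n ℕ.+ (n ℕ.+ L ℕ.* n))) ℕ.+ (3 ℕ.* (n ℕ.* L) ℕ.+ 2 ℕ.* (L ℕ.* L))
    ≡⟨ expand n L ⟩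
  2 ℕ.* ((n ℕ.+ L) ℕ.* (n ℕ.+ L)) ℕ.+ (n ℕ.+ L) ∎
  where
  open ℕ.≤-Reasoning
  expand : ∀ n L → n ℕ.* n ℕ.+ (L ℕ.+ (n ℕ.* n ℕ.+ (n ℕ.+ L ℕ.* n))) ℕ.+ (3 ℕ.* (n ℕ.* L) ℕ.+ 2 ℕ.* (L ℕ.* L))
                    ≡ 2 ℕ.* ((n ℕ.+ L) ℕ.* (n ℕ.+ L)) ℕ.+ (n ℕ.+ L)
  expand = solve-∀ℕ

∏-cong : ∀ N {f g : Fin N → ℕ} → f ≗ g → ∏ N f ≡ ∏ N g
∏-cong zero    f≗g = refl
∏-cong (suc N) f≗g = cong₂ ℕ._*_ (f≗g zero) (∏-cong N (f≗g ∘ suc))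

1≤∏ : ∀ N (f : Fin N → ℕ) → (∀ j → 1 ≤ f j) → 1 ≤ ∏ N f
1≤∏ zero    f 1≤f = ℕ.≤-refl
1≤∏ (suc N) f 1≤f = ℕ.*-mono-≤ (1≤f zero) (1≤∏ N (f ∘ suc) (1≤f ∘ suc))

∏≤2^∑ : ∀ N (b e : Fin N → ℕ) → (∀ j → b j ≤ 2 ℕ.^ e j) → ∏ N b ≤ 2 ℕ.^ ∑ N e
∏≤2^∑ zero    b e b≤ = ℕ.≤-refl
∏≤2^∑ (suc N) b e b≤ = ℕ.≤-trans (ℕ.*-mono-≤ (b≤ zero) (∏≤2^∑ N (b ∘ suc) (e ∘ suc) (b≤ ∘ suc)))
                                (ℕ.≤-reflexive (sym (ℕ.^-distribˡ-+-* 2 (e zero) _)))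

∏+∑≤∏+ : ∀ N (n L : Fin N → ℕ) → (∀ j → 1 ≤ n j) → ∏ N n ℕ.+ ∑ N L ≤ ∏ N (λ j → n j ℕ.+ L j)
∏+∑≤∏+ zero    n L _   = ℕ.≤-refl
∏+∑≤∏+ (suc N) n L 1≤n = begin
  n₀ ℕ.* P ℕ.+ (L₀ ℕ.+ S)              ≤⟨ ℕ.+-monoʳ-≤ (n₀ ℕ.* P) (ℕ.+-mono-≤ (ℕ.m≤m*n L₀ Q {{ℕ.>-nonZero 1≤Q}}) (ℕ.m≤n*m S n₀ {{ℕ.>-nonZero (1≤n zero)}})) ⟩
  n₀ ℕ.* P ℕ.+ (L₀ ℕ.* Q ℕ.+ n₀ ℕ.* S)  ≡⟨ rearrange n₀ P L₀ Q S ⟩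
  n₀ ℕ.* (P ℕ.+ S) ℕ.+ L₀ ℕ.* Q        ≤⟨ ℕ.+-monoˡ-≤ (L₀ ℕ.* Q) (ℕ.*-monoʳ-≤ n₀ IH) ⟩
  n₀ ℕ.* Q ℕ.+ L₀ ℕ.* Q                ≡⟨ ℕ.*-distribʳ-+ Q n₀ L₀ ⟨
  (n₀ ℕ.+ L₀) ℕ.* Q                    ∎
  where
  open ℕ.≤-Reasoning
  n₀ = n zero
  L₀ = L zero
  P = ∏ N (n ∘ suc)
  S = ∑ N (L ∘ suc)
  Q = ∏ N (λ j → n (suc j) ℕ.+ L (suc j))
  IH : P ℕ.+ S ≤ Q
  IH = ∏+∑≤∏+ N (n ∘ suc) (L ∘ suc) (1≤n ∘ suc)
  1≤Q : 1 ≤ Q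
  1≤Q = ℕ.≤-trans (1≤∏ N (n ∘ suc) (1≤n ∘ suc)) (ℕ.≤-trans (ℕ.m≤m+n P S) IH)
  rearrange : ∀ n₀ P L₀ Q S → n₀ ℕ.* P ℕ.+ (L₀ ℕ.* Q ℕ.+ n₀ ℕ.* S) ≡ n₀ ℕ.* (P ℕ.+ S) ℕ.+ L₀ ℕ.* Q
  rearrange = solve-∀ℕ

-- Integer matrices and Kronecker products

Matrix : ℕ → Set
Matrix n = Fin n → Fin n → ℤ

infixr 8 _*ᵥ_
infixl 9 _⊗_ _⊗ᵥ_

_*ᵥ_ : ∀ {n} → Matrix n → Vector ℤ n → Vector ℤ n
_*ᵥ_ {n} A v r = ∑[ c < n ] (A r c * v c)

Bounded : ∀ {n} → ℕ → Matrix n → Set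
Bounded b A = ∀ r c → ∣ A r c ∣ ≤ b

negate : ∀ {n} → Matrix n → Matrix n
negate A r c = - A r c

negate-*ᵥ : ∀ {n} (A : Matrix n) v r → (negate A *ᵥ v) r ≡ - (A *ᵥ v) r
negate-*ᵥ A v r = trans (sum-cong-≗ (λ c → sym (ℤ.neg-distribˡ-* (A r c) (v c)))) (∑-neg (λ c → A r c * v c))

negate-bounded : ∀ {n b} {A : Matrix n} → Bounded b A → Bounded b (negate A)
negate-bounded {A = A} A≤b r c = ℕ.≤-trans (ℕ.≤-reflexive (ℤ.∣-i∣≡∣i∣ (A r c))) (A≤b r c)

scalar : ∀ {n} → ℤ → Matrix n
scalar s r c = s * δ r c

scalar-*ᵥ : ∀ {n} s (v : Vector ℤ n) r → (scalar s *ᵥ v) r ≡ s * v r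
scalar-*ᵥ s v r = trans (sum-cong-≗ (λ c → trans (ℤ.*-assoc s (δ r c) (v c)) (cong (s *_) (cong (_* v c) (δ-sym r c)))))
                 (trans (sym (*-distribˡ-sum s (λ c → δ c r * v c))) (cong (s *_) (∑-δ v r)))

scalar-bounded : ∀ {n} s → Bounded ∣ s ∣ (scalar {n} s)
scalar-bounded s r c = ℕ.≤-trans (ℕ.≤-reflexive (ℤ.abs-* s (δ r c))) (ℕ.≤-trans (ℕ.*-monoʳ-≤ ∣ s ∣ (∣δ∣≤1 r c)) (ℕ.≤-reflexive (ℕ.*-identityʳ _)))

_⊗_ : ∀ {m n} → Matrix m → Matrix n → Matrix (m ℕ.* n)
_⊗_ {m} {n} A B X Y = A (quotient n X) (quotient n Y) * B (remainder {m} n X) (remainder {m} n Y)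

_⊗ᵥ_ : ∀ {m n} → Vector ℤ m → Vector ℤ n → Vector ℤ (m ℕ.* n)
_⊗ᵥ_ {m} {n} v w X = v (quotient n X) * w (remainder {m} n X)

quotient-combine : ∀ {m n} (i : Fin m) (j : Fin n) → quotient n (combine i j) ≡ i
quotient-combine i j = cong Σ.proj₁ (Fin.remQuot-combine i j)

remainder-combine : ∀ {m n} (i : Fin m) (j : Fin n) → remainder {m} n (combine i j) ≡ j
remainder-combine i j = cong Σ.proj₂ (Fin.remQuot-combine i j)

⊗ᵥ-combine : ∀ {m n} (v : Vector ℤ m) (w : Vector ℤ n) i j → (v ⊗ᵥ w) (combine i j) ≡ v i * w j
⊗ᵥ-combine v w i j = cong₂ (λ i′ j′ → v i′ * w j′) (quotient-combine i j) (remainder-combine i j)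

⊗-*ᵥ-⊗ᵥ : ∀ {m n} (A : Matrix m) (B : Matrix n) v w X →
           ((A ⊗ B) *ᵥ (v ⊗ᵥ w)) X ≡ (A *ᵥ v) (quotient n X) * (B *ᵥ w) (remainder {m} n X)
⊗-*ᵥ-⊗ᵥ {m} {n} A B v w X = begin
  ∑[ Y < m ℕ.* n ] ((A ⊗ B) X Y * (v ⊗ᵥ w) Y)
    ≡⟨ ∑-combine m n _ ⟩
  ∑[ c < m ] ∑[ d < n ] ((A ⊗ B) X (combine c d) * (v ⊗ᵥ w) (combine c d))
    ≡⟨ sum-cong-≗ (λ c → sum-cong-≗ (λ d → entry c d)) ⟩
  ∑[ c < m ] ∑[ d < n ] ((A i c * v c) * (B j d * w d))
    ≡⟨ sum-cong-≗ (λ c → sym (*-distribˡ-sum (A i c * v c) (λ d → B j d * w d))) ⟩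
  ∑[ c < m ] ((A i c * v c) * (B *ᵥ w) j)
    ≡⟨ sym (*-distribʳ-sum ((B *ᵥ w) j) (λ c → A i c * v c)) ⟩
  (A *ᵥ v) i * (B *ᵥ w) j ∎
  where
  open ≡-Reasoning
  i = quotient n X
  j = remainder {m} n X
  entry : ∀ c d → (A ⊗ B) X (combine c d) * (v ⊗ᵥ w) (combine c d) ≡ (A i c * v c) * (B j d * w d)
  entry c d = trans (cong₂ (λ c′ d′ → (A i c′ * B j d′) * (v c′ * w d′)) (quotient-combine c d) (remainder-combine c d))
                    (*-interchange (A i c) (B j d) (v c) (w d))

⊗-bounded : ∀ {m n a b} {A : Matrix m} {B : Matrix n} → Bounded a A → Bounded b B → Bounded (a ℕ.* b) (A ⊗ B)
⊗-bounded {m} {n} {A = A} {B} A≤a B≤b X Y =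
  ℕ.≤-trans (ℕ.≤-reflexive (ℤ.abs-* (A _ _) (B (remainder {m} n X) (remainder {m} n Y)))) (ℕ.*-mono-≤ (A≤a _ _) (B≤b _ _))

-- Determinants

sumMaps : ∀ d n → ((Fin d → Fin n) → ℤ) → ℤ
sumMaps zero    n g = g (λ ())
sumMaps (suc d) n g = ∑[ a < n ] sumMaps d n (λ σ → g (a ∷ σ))

Extensional : ∀ {d n} → ((Fin d → Fin n) → ℤ) → Set
Extensional g = ∀ {σ τ} → σ ≗ τ → g σ ≡ g τ

module _ (n : ℕ) where

  sumMaps-cong : ∀ d {g h : (Fin d → Fin n) → ℤ} → (∀ σ → g σ ≡ h σ) → sumMaps d n g ≡ sumMaps d n h
  sumMaps-cong zero    g≡h = g≡h _
  sumMaps-cong (suc d) g≡h = sum-cong-≗ (λ a → sumMaps-cong d (λ σ → g≡h (a ∷ σ)))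

  sumMaps-neg : ∀ d (g : (Fin d → Fin n) → ℤ) → sumMaps d n (λ σ → - g σ) ≡ - sumMaps d n g
  sumMaps-neg zero    g = refl
  sumMaps-neg (suc d) g = trans (sum-cong-≗ (λ a → sumMaps-neg d (λ σ → g (a ∷ σ)))) (∑-neg (λ a → sumMaps d n (λ σ → g (a ∷ σ))))

  sumMaps-zero : ∀ d (g : (Fin d → Fin n) → ℤ) → (∀ σ → g σ ≡ 0ℤ) → sumMaps d n g ≡ 0ℤ
  sumMaps-zero zero    g g≡0 = g≡0 _
  sumMaps-zero (suc d) g g≡0 = ∑-zero (λ a → sumMaps d n (λ σ → g (a ∷ σ))) (λ a → sumMaps-zero d (λ σ → g (a ∷ σ)) (λ σ → g≡0 (a ∷ σ)))

  sumMaps-*ˡ : ∀ d c (g : (Fin d → Fin n) → ℤ) → sumMaps d n (λ σ → c * g σ) ≡ c * sumMaps d n g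
  sumMaps-*ˡ zero    c g = refl
  sumMaps-*ˡ (suc d) c g = trans (sum-cong-≗ (λ a → sumMaps-*ˡ d c (λ σ → g (a ∷ σ)))) (sym (*-distribˡ-sum c (λ a → sumMaps d n (λ σ → g (a ∷ σ)))))

  sumMaps-*ʳ : ∀ d c (g : (Fin d → Fin n) → ℤ) → sumMaps d n (λ σ → g σ * c) ≡ sumMaps d n g * c
  sumMaps-*ʳ d c g = trans (sumMaps-cong d (λ σ → ℤ.*-comm (g σ) c)) (trans (sumMaps-*ˡ d c g) (ℤ.*-comm c _))

  sumMaps-∑ : ∀ d m (g : (Fin d → Fin n) → Fin m → ℤ) → sumMaps d n (λ σ → ∑[ c < m ] g σ c) ≡ ∑[ c < m ] sumMaps d n (λ σ → g σ c)
  sumMaps-∑ zero    m g = refl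
  sumMaps-∑ (suc d) m g = trans (sum-cong-≗ (λ a → sumMaps-∑ d m (λ σ → g (a ∷ σ)))) (∑-comm (λ a c → sumMaps d n (λ σ → g (a ∷ σ) c)))

  ∣sumMaps∣≤ : ∀ d (g : (Fin d → Fin n) → ℤ) b → (∀ σ → ∣ g σ ∣ ≤ b) → ∣ sumMaps d n g ∣ ≤ n ℕ.^ d ℕ.* b
  ∣sumMaps∣≤ zero    g b g≤b = ℕ.≤-trans (g≤b _) (ℕ.≤-reflexive (sym (ℕ.+-identityʳ b)))
  ∣sumMaps∣≤ (suc d) g b g≤b = ℕ.≤-trans (∣∑∣≤ (λ a → sumMaps d n (λ σ → g (a ∷ σ))) (n ℕ.^ d ℕ.* b) (λ a → ∣sumMaps∣≤ d (λ σ → g (a ∷ σ)) b (λ σ → g≤b (a ∷ σ))))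
                                         (ℕ.≤-reflexive (sym (ℕ.*-assoc n (n ℕ.^ d) b)))

  sumMaps-δ : ∀ d (g : (Fin d → Fin n) → ℤ) → Extensional g → (τ : Fin d → Fin n) →
              sumMaps d n (λ σ → g σ * product (λ i → δ (σ i) (τ i))) ≡ g τ
  sumMaps-δ zero    g ext τ = trans (ℤ.*-identityʳ _) (ext (λ ()))
  sumMaps-δ (suc d) g ext τ = begin
    ∑[ a < n ] sumMaps d n (λ σ → g (a ∷ σ) * (δ a (τ zero) * Δ σ))
      ≡⟨ sum-cong-≗ (λ a → sumMaps-cong d (λ σ → *-left-comm (g (a ∷ σ)) (δ a (τ zero)) (Δ σ))) ⟩
    ∑[ a < n ] sumMaps d n (λ σ → δ a (τ zero) * (g (a ∷ σ) * Δ σ))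
      ≡⟨ sum-cong-≗ (λ a → sumMaps-*ˡ d (δ a (τ zero)) (λ σ → g (a ∷ σ) * Δ σ)) ⟩
    ∑[ a < n ] (δ a (τ zero) * sumMaps d n (λ σ → g (a ∷ σ) * Δ σ))
      ≡⟨ sum-cong-≗ (λ a → cong (δ a (τ zero) *_) (sumMaps-δ d (λ σ → g (a ∷ σ)) (λ σ≗τ → ext (λ { zero → refl ; (suc i) → σ≗τ i })) (τ ∘ suc))) ⟩
    ∑[ a < n ] (δ a (τ zero) * g (a ∷ τ ∘ suc))
      ≡⟨ ∑-δ (λ a → g (a ∷ τ ∘ suc)) (τ zero) ⟩
    g (τ zero ∷ τ ∘ suc)
      ≡⟨ ext (λ { zero → refl ; (suc i) → refl }) ⟩
    g τ ∎
    where
    open ≡-Reasoning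
    Δ : (Fin d → Fin n) → ℤ
    Δ σ = product (λ i → δ (σ i) (τ (suc i)))

swapAdjacent : ∀ {d} → Fin (suc d) → Fin (suc (suc d)) → Fin (suc (suc d))
swapAdjacent zero             zero          = suc zero
swapAdjacent zero             (suc zero)    = zero
swapAdjacent zero             (suc (suc j)) = suc (suc j)
swapAdjacent {suc d} (suc c) zero           = zero
swapAdjacent {suc d} (suc c) (suc j)        = suc (swapAdjacent c j)

swapAdjacent-involutive : ∀ {d} (c : Fin (suc d)) i → swapAdjacent c (swapAdjacent c i) ≡ i
swapAdjacent-involutive zero             zero          = refl
swapAdjacent-involutive zero             (suc zero)    = refl
swapAdjacent-involutive zero             (suc (suc j)) = refl
swapAdjacent-involutive {suc d} (suc c) zero           = refl
swapAdjacent-involutive {suc d} (suc c) (suc j)        = cong suc (swapAdjacent-involutive c j)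

swapAdjacent-lower : ∀ {d} (c : Fin (suc d)) → swapAdjacent c (inject₁ c) ≡ suc c
swapAdjacent-lower zero             = refl
swapAdjacent-lower {suc d} (suc c) = cong suc (swapAdjacent-lower c)

swapAdjacent-upper : ∀ {d} (c : Fin (suc d)) → swapAdjacent c (suc c) ≡ inject₁ c
swapAdjacent-upper zero             = refl
swapAdjacent-upper {suc d} (suc c) = cong suc (swapAdjacent-upper c)

swapAdjacent-other : ∀ {d} (c : Fin (suc d)) i → toℕ i ≢ toℕ c → toℕ i ≢ suc (toℕ c) → swapAdjacent c i ≡ i
swapAdjacent-other zero             zero          i≢c _   = ⊥-elim (i≢c refl)
swapAdjacent-other zero             (suc zero)    _   i≢c' = ⊥-elim (i≢c' refl)
swapAdjacent-other zero             (suc (suc j)) _   _   = refl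
swapAdjacent-other {suc d} (suc c) zero           _   _   = refl
swapAdjacent-other {suc d} (suc c) (suc j)        i≢c i≢c' = cong suc (swapAdjacent-other c j (i≢c ∘ cong suc) (i≢c' ∘ cong suc))

product-swapAdjacent : ∀ {d} (c : Fin (suc d)) (f : Vector ℤ (suc (suc d))) → product (f ∘ swapAdjacent c) ≡ product f
product-swapAdjacent zero             f = *-left-comm (f (suc zero)) (f zero) _
product-swapAdjacent {suc d} (suc c) f = cong (f zero *_) (product-swapAdjacent c (f ∘ suc))

sumMaps-swapAdjacent : ∀ {d} n (c : Fin (suc d)) (g : (Fin (suc (suc d)) → Fin n) → ℤ) → Extensional g →
                       sumMaps (suc (suc d)) n (λ σ → g (σ ∘ swapAdjacent c)) ≡ sumMaps (suc (suc d)) n g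
sumMaps-swapAdjacent {d} n zero g ext =
  trans (sum-cong-≗ (λ a → sum-cong-≗ (λ b → sumMaps-cong n d (swap-first-two a b)))) (∑-comm (λ a b → sumMaps d n (λ σ → g (b ∷ a ∷ σ))))
  where
  swap-first-two : ∀ a b σ → g ((a ∷ b ∷ σ) ∘ swapAdjacent zero) ≡ g (b ∷ a ∷ σ)
  swap-first-two a b σ = ext (λ { zero → refl ; (suc zero) → refl ; (suc (suc j)) → refl })
sumMaps-swapAdjacent {suc d} n (suc c) g ext = sum-cong-≗ (λ a →
  trans (sumMaps-cong n (suc (suc d)) (λ σ → ext {σ = (a ∷ σ) ∘ swapAdjacent (suc c)} {τ = a ∷ σ ∘ swapAdjacent c} (λ { zero → refl ; (suc j) → refl })))
        (sumMaps-swapAdjacent n c (λ σ → g (a ∷ σ)) (λ {σ} {τ} σ≗τ → ext {σ = a ∷ σ} {τ = a ∷ τ} (λ { zero → refl ; (suc j) → σ≗τ j }))))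

vandermonde : ∀ {d} → Vector ℤ d → ℤ
vandermonde {zero}  x = 1ℤ
vandermonde {suc d} x = product (λ j → x (suc j) - x zero) * vandermonde (x ∘ suc)

vandermonde-cong : ∀ {d} {x y : Vector ℤ d} → x ≗ y → vandermonde x ≡ vandermonde y
vandermonde-cong {zero}  x≗y = refl
vandermonde-cong {suc d} x≗y = cong₂ _*_ (product-cong-≗ (λ j → cong₂ _-_ (x≗y (suc j)) (x≗y zero))) (vandermonde-cong (x≗y ∘ suc))

vandermonde-swapAdjacent : ∀ {d} (c : Fin (suc d)) (x : Vector ℤ (suc (suc d))) → vandermonde (x ∘ swapAdjacent c) ≡ - vandermonde x
vandermonde-swapAdjacent {d} zero x = reorder (x zero) (x (suc zero)) (product (λ j → x (suc (suc j)) - x (suc zero)))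
                                              (product (λ j → x (suc (suc j)) - x zero)) (vandermonde (λ j → x (suc (suc j))))
  where
  reorder : ∀ x₀ x₁ A B V → ((x₀ - x₁) * A) * (B * V) ≡ - (((x₁ - x₀) * B) * (A * V))
  reorder = solve-∀
vandermonde-swapAdjacent {suc d} (suc c) x =
  trans (cong₂ _*_ (product-swapAdjacent c (λ j → x (suc j) - x zero)) (vandermonde-swapAdjacent c (x ∘ suc)))
        (sym (ℤ.neg-distribʳ-* (product (λ j → x (suc j) - x zero)) (vandermonde (x ∘ suc))))

data IsPositive : ℤ → Set where
  positive : ∀ k → IsPositive +[1+ k ]

*-positive : ∀ {a b} → IsPositive a → IsPositive b → IsPositive (a * b)
*-positive (positive k) (positive l) = positive _

product-positive : ∀ {d} (f : Vector ℤ d) → (∀ j → IsPositive (f j)) → IsPositive (product f)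
product-positive {zero}  f pos = positive 0
product-positive {suc d} f pos = *-positive (pos zero) (product-positive (f ∘ suc) (pos ∘ suc))

vandermonde-increasing : ∀ d c → IsPositive (vandermonde {d} (λ i → + (c ℕ.+ toℕ i)))
vandermonde-increasing zero    c = positive 0
vandermonde-increasing (suc d) c = *-positive (product-positive {d} (λ j → x (suc j) - x zero) gap-positive) shifted-positive
  where
  x : Vector ℤ (suc d)
  x i = + (c ℕ.+ toℕ i)
  gap-positive : ∀ j → IsPositive (x (suc j) - x zero)
  gap-positive j = subst IsPositive (sym (trans (cong₂ _-_ (ℤ.pos-+ c (suc (toℕ j))) (ℤ.pos-+ c 0)) (cancel (+ c) +[1+ toℕ j ])))
                                    (positive (toℕ j))
    where
    cancel : ∀ C T → (C + T) - (C + 0ℤ) ≡ T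
    cancel = solve-∀
  shifted-positive : IsPositive (vandermonde (x ∘ suc))
  shifted-positive = subst IsPositive (vandermonde-cong {d} {x = λ j → + (suc c ℕ.+ toℕ j)} (λ j → cong +_ (sym (ℕ.+-suc c (toℕ j)))))
                                     (vandermonde-increasing d (suc c))

signum : ℤ → ℤ
signum (+ zero)   = 0ℤ
signum +[1+ n ]   = 1ℤ
signum -[1+ n ]   = - 1ℤ

signum-neg : ∀ z → signum (- z) ≡ - signum z
signum-neg (+ zero)   = refl
signum-neg +[1+ n ]   = refl
signum-neg -[1+ n ]   = refl

∣signum∣≤1 : ∀ z → ∣ signum z ∣ ≤ 1
∣signum∣≤1 (+ zero)   = z≤n
∣signum∣≤1 +[1+ n ]   = ℕ.≤-refl
∣signum∣≤1 -[1+ n ]   = ℕ.≤-refl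

-- The Leibniz sum runs over all maps Fin n → Fin n: the sign of the Vandermonde product
-- ∏_{i<j} (σ j − σ i) vanishes unless σ is a permutation.
sign : ∀ {n} → (Fin n → Fin n) → ℤ
sign σ = signum (vandermonde (λ i → + toℕ (σ i)))

sign-extensional : ∀ {n} → Extensional (sign {n})
sign-extensional σ≗τ = cong signum (vandermonde-cong (λ i → cong (λ t → + toℕ t) (σ≗τ i)))

sign-swapAdjacent : ∀ {d} (c : Fin (suc d)) (σ : Fin (suc (suc d)) → Fin (suc (suc d))) → sign (σ ∘ swapAdjacent c) ≡ - sign σ
sign-swapAdjacent c σ = trans (cong signum (vandermonde-swapAdjacent c (λ i → + toℕ (σ i)))) (signum-neg (vandermonde (λ i → + toℕ (σ i))))

sign-id : ∀ n → sign {n} (λ i → i) ≡ 1ℤ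
sign-id n with vandermonde {n} (λ i → + toℕ i) | vandermonde-increasing n 0
... | _ | positive k = refl

det : ∀ {n} → Matrix n → ℤ
det {n} A = sumMaps n n (λ σ → sign σ * product (λ i → A (σ i) i))

det-cong : ∀ {n} {A B : Matrix n} → (∀ r c → A r c ≡ B r c) → det A ≡ det B
det-cong {n} A≡B = sumMaps-cong n n (λ σ → cong (sign σ *_) (product-cong-≗ (λ i → A≡B (σ i) i)))

det-swapAdjacentColumns : ∀ {d} (c : Fin (suc d)) (A : Matrix (suc (suc d))) → det (λ r i → A r (swapAdjacent c i)) ≡ - det A
det-swapAdjacentColumns {d} c A = begin
  sumMaps N N (λ σ → sign σ * product (λ i → A (σ i) (swapAdjacent c i)))
    ≡⟨ sumMaps-cong N N (λ σ → cong₂ _*_ (sign-extensional (λ i → cong σ (sym (swapAdjacent-involutive c i)))) (unswap σ)) ⟩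
  sumMaps N N (λ σ → g (σ ∘ swapAdjacent c))
    ≡⟨ sumMaps-swapAdjacent N c g g-extensional ⟩
  sumMaps N N g
    ≡⟨ sumMaps-cong N N (λ τ → trans (cong (_* T τ) (sign-swapAdjacent c τ)) (sym (ℤ.neg-distribˡ-* (sign τ) (T τ)))) ⟩
  sumMaps N N (λ τ → - (sign τ * T τ))
    ≡⟨ sumMaps-neg N N (λ τ → sign τ * T τ) ⟩
  - det A ∎
  where
  open ≡-Reasoning
  N = suc (suc d)
  T : (Fin N → Fin N) → ℤ
  T τ = product (λ i → A (τ i) i)
  g : (Fin N → Fin N) → ℤ
  g τ = sign (τ ∘ swapAdjacent c) * T τ
  g-extensional : Extensional g
  g-extensional σ≗τ = cong₂ _*_ (sign-extensional (σ≗τ ∘ swapAdjacent c)) (product-cong-≗ (λ i → cong (λ t → A t i) (σ≗τ i)))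
  unswap : ∀ σ → product (λ i → A (σ i) (swapAdjacent c i)) ≡ T (σ ∘ swapAdjacent c)
  unswap σ = trans (product-cong-≗ (λ i → cong (λ j → A (σ j) (swapAdjacent c i)) (sym (swapAdjacent-involutive c i))))
                   (product-swapAdjacent c (λ j → A (σ (swapAdjacent c j)) j))

private
  x≡-x⇒x≡0 : ∀ {x} → x ≡ - x → x ≡ 0ℤ
  x≡-x⇒x≡0 {+ zero}   _ = refl
  x≡-x⇒x≡0 {+[1+ n ]} ()
  x≡-x⇒x≡0 { -[1+ n ]} ()

det-equalColumns : ∀ {n} (A : Matrix n) {c c' : Fin n} → toℕ c < toℕ c' → (∀ r → A r c ≡ A r c') → det A ≡ 0ℤ
det-equalColumns A {c} {c'} c<c' Ac≡Ac' = go A c' (toℕ c' ℕ.∸ suc (toℕ c)) (sym (ℕ.m+[n∸m]≡n c<c')) Ac≡Ac'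
  where
  -- Swapping equal adjacent columns fixes A but negates det A; otherwise move column c' one step towards c.
  go : ∀ {n} (A : Matrix n) {c : Fin n} (c' : Fin n) k → toℕ c' ≡ suc (toℕ c ℕ.+ k) → (∀ r → A r c ≡ A r c') → det A ≡ 0ℤ
  go {suc (suc d)} A {c} (suc a) zero    c'≡ Ac≡Ac' = x≡-x⇒x≡0 (trans (sym (det-cong swap-fixes)) (det-swapAdjacentColumns a A))
    where
    c≡a : c ≡ inject₁ a
    c≡a = Fin.toℕ-injective (trans (ℕ.suc-injective (trans (cong suc (sym (ℕ.+-identityʳ _))) (sym c'≡))) (sym (Fin.toℕ-inject₁ a)))
    swap-fixes : ∀ r i → A r (swapAdjacent a i) ≡ A r i
    swap-fixes r i with i Fin.≟ inject₁ a | i Fin.≟ suc a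
    ... | yes refl | _        = trans (cong (A r) (swapAdjacent-lower a)) (trans (sym (Ac≡Ac' r)) (cong (A r) c≡a))
    ... | no _     | yes refl = trans (cong (A r) (swapAdjacent-upper a)) (trans (cong (A r) (sym c≡a)) (Ac≡Ac' r))
    ... | no i≢a   | no i≢a'  = cong (A r) (swapAdjacent-other a i (λ i≡a → i≢a (Fin.toℕ-injective (trans i≡a (sym (Fin.toℕ-inject₁ a)))))
                                                                   (i≢a' ∘ Fin.toℕ-injective))
  go {suc (suc d)} A {c} (suc a) (suc k) c'≡ Ac≡Ac' =
    trans (sym (ℤ.neg-involutive _)) (trans (cong -_ (sym (det-swapAdjacentColumns a A))) (cong -_ (go B (inject₁ a) k a≡ Bc≡Ba)))
    where
    B : Matrix (suc (suc d))
    B r i = A r (swapAdjacent a i)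
    a≡ : toℕ (inject₁ a) ≡ suc (toℕ c ℕ.+ k)
    a≡ = trans (Fin.toℕ-inject₁ a) (ℕ.suc-injective (trans c'≡ (cong suc (ℕ.+-suc (toℕ c) k))))
    c<a : toℕ c < toℕ a
    c<a = ℕ.≤-trans (s≤s (ℕ.m≤m+n (toℕ c) k)) (ℕ.≤-reflexive (sym (trans (sym (Fin.toℕ-inject₁ a)) a≡)))
    Bc≡Ba : ∀ r → B r c ≡ B r (inject₁ a)
    Bc≡Ba r = trans (cong (A r) (swapAdjacent-other a c (λ c≡a → ℕ.<-irrefl c≡a c<a) (λ c≡a' → ℕ.<-irrefl c≡a' (ℕ.m<n⇒m<1+n c<a))))
                    (trans (Ac≡Ac' r) (cong (A r) (sym (swapAdjacent-lower a))))

replaceColumn : ∀ {n} → Matrix n → Fin n → Vector ℤ n → Matrix n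
replaceColumn A c u r = updateAt (A r) c (const (u r))

module _ {n} (A : Matrix (suc n)) (c : Fin (suc n)) where

  minorTerm : (Fin (suc n) → Fin (suc n)) → ℤ
  minorTerm σ = product (removeAt (λ i → A (σ i) i) c)

  det-replaceColumn : ∀ u → det (replaceColumn A c u) ≡ sumMaps (suc n) (suc n) (λ σ → sign σ * (u (σ c) * minorTerm σ))
  det-replaceColumn u = sumMaps-cong (suc n) (suc n) (λ σ → cong (sign σ *_) (trans (product-remove {i = c} (λ i → replaceColumn A c u (σ i) i))
    (cong₂ _*_ (updateAt-updates c {const (u (σ c))} (A (σ c)))
               (product-cong-≗ (λ j → updateAt-minimal (punchIn c j) c (A (σ (punchIn c j))) (Fin.punchInᵢ≢i c j))))))

  det-replaceColumn-linear : ∀ v → det (replaceColumn A c (A *ᵥ v)) ≡ ∑[ j < suc n ] (v j * det (replaceColumn A c (λ r → A r j)))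
  det-replaceColumn-linear v = begin
    det (replaceColumn A c (A *ᵥ v))
      ≡⟨ det-replaceColumn (A *ᵥ v) ⟩
    sumMaps N N (λ σ → sign σ * ((A *ᵥ v) (σ c) * minorTerm σ))
      ≡⟨ sumMaps-cong N N expand ⟩
    sumMaps N N (λ σ → ∑[ j < N ] (v j * (sign σ * (A (σ c) j * minorTerm σ))))
      ≡⟨ sumMaps-∑ N N N (λ σ j → v j * (sign σ * (A (σ c) j * minorTerm σ))) ⟩
    ∑[ j < N ] sumMaps N N (λ σ → v j * (sign σ * (A (σ c) j * minorTerm σ)))
      ≡⟨ sum-cong-≗ (λ j → sumMaps-*ˡ N N (v j) (λ σ → sign σ * (A (σ c) j * minorTerm σ))) ⟩
    ∑[ j < N ] (v j * sumMaps N N (λ σ → sign σ * (A (σ c) j * minorTerm σ)))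
      ≡⟨ sum-cong-≗ (λ j → cong (v j *_) (sym (det-replaceColumn (λ r → A r j)))) ⟩
    ∑[ j < N ] (v j * det (replaceColumn A c (λ r → A r j))) ∎
    where
    open ≡-Reasoning
    N = suc n
    expand : ∀ σ → sign σ * ((A *ᵥ v) (σ c) * minorTerm σ) ≡ ∑[ j < N ] (v j * (sign σ * (A (σ c) j * minorTerm σ)))
    expand σ = trans (cong (sign σ *_) (*-distribʳ-sum (minorTerm σ) (λ j → A (σ c) j * v j)))
               (trans (*-distribˡ-sum (sign σ) (λ j → (A (σ c) j * v j) * minorTerm σ)) (sum-cong-≗ (λ j → reorder (sign σ) (A (σ c) j) (v j) (minorTerm σ))))
      where
      reorder : ∀ s a x m → s * ((a * x) * m) ≡ x * (s * (a * m))
      reorder = solve-∀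

  det-replaceColumn-*ᵥ : ∀ v → det (replaceColumn A c (A *ᵥ v)) ≡ v c * det A
  det-replaceColumn-*ᵥ v = trans (det-replaceColumn-linear v) (trans (∑-single (λ j → v j * det (replaceColumn A c (λ r → A r j))) c other) (cong (v c *_) self))
    where
    self : det (replaceColumn A c (λ r → A r c)) ≡ det A
    self = det-cong (λ r → updateAt-id-local c (A r) refl)
    other : ∀ j → j ≢ c → v j * det (replaceColumn A c (λ r → A r j)) ≡ 0ℤ
    other j j≢c = trans (cong (v j *_) (equal j≢c (ℕ.<-cmp (toℕ c) (toℕ j)))) (ℤ.*-zeroʳ (v j))
      where
      B = replaceColumn A c (λ r → A r j)
      B-c : ∀ r → B r c ≡ B r j
      B-c r = trans (updateAt-updates c (A r)) (sym (updateAt-minimal j c (A r) j≢c))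
      equal : j ≢ c → Tri (toℕ c < toℕ j) (toℕ c ≡ toℕ j) (toℕ j < toℕ c) → det B ≡ 0ℤ
      equal _   (tri< c<j _ _) = det-equalColumns B c<j B-c
      equal j≢c (tri≈ _ c≡j _) = ⊥-elim (j≢c (Fin.toℕ-injective (sym c≡j)))
      equal _   (tri> _ _ j<c) = det-equalColumns B j<c (λ r → sym (B-c r))

-- Polynomials and characteristic polynomials

∑ℕ : ℕ → (ℕ → ℤ) → ℤ
∑ℕ N f = ∑[ i < N ] f (toℕ i)

∑ℕ-cong : ∀ N {f g : ℕ → ℤ} → (∀ i → i < N → f i ≡ g i) → ∑ℕ N f ≡ ∑ℕ N g
∑ℕ-cong N f≡g = sum-cong-≗ {N} (λ i → f≡g (toℕ i) (Fin.toℕ<n i))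

∑ℕ-suc : ∀ N f → ∑ℕ (suc N) f ≡ ∑ℕ N f + f N
∑ℕ-suc N f = trans (sum-init-last {N} (f ∘ toℕ)) (cong₂ _+_ (sum-cong-≗ {N} (cong f ∘ Fin.toℕ-inject₁)) (cong f (Fin.toℕ-fromℕ N)))

∑ℕ-+ : ∀ m n f → ∑ℕ (m ℕ.+ n) f ≡ ∑ℕ m f + ∑ℕ n (λ t → f (m ℕ.+ t))
∑ℕ-+ m n f = trans (∑-++ m n (f ∘ toℕ)) (cong₂ _+_ (sum-cong-≗ {m} (λ i → cong f (Fin.toℕ-↑ˡ i n))) (sum-cong-≗ {n} (λ j → cong f (Fin.toℕ-↑ʳ m j))))

∑ℕ-reverse : ∀ N f → ∑ℕ N f ≡ ∑ℕ N (λ s → f (N ℕ.∸ suc s))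
∑ℕ-reverse zero    f = refl
∑ℕ-reverse (suc N) f = trans (∑ℕ-suc N f) (trans (ℤ.+-comm (∑ℕ N f) (f N)) (cong (_+_ (f N)) (∑ℕ-reverse N f)))

eval : ℕ → (ℕ → ℤ) → ℤ → ℤ
eval N q x = ∑ℕ N (λ i → q i * x ^ i)

shiftUp : (ℕ → ℤ) → ℕ → ℤ
shiftUp q zero    = 0ℤ
shiftUp q (suc k) = q k

eval-shiftUp : ∀ N q x → eval (suc N) (shiftUp q) x ≡ x * eval N q x
eval-shiftUp N q x = trans (cong (_+ ∑[ i < N ] (q (toℕ i) * x ^ suc (toℕ i))) (ℤ.*-zeroˡ 1ℤ))
  (trans (ℤ.+-identityˡ _) (trans (sum-cong-≗ {N} (λ i → *-left-comm (q (toℕ i)) x (x ^ toℕ i))) (sym (*-distribˡ-sum {N} x (λ i → q (toℕ i) * x ^ toℕ i)))))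

linearProduct : ∀ d → Vector ℤ d → Vector ℤ d → ℕ → ℤ
linearProduct zero    α β zero    = 1ℤ
linearProduct zero    α β (suc k) = 0ℤ
linearProduct (suc d) α β k       = α zero * q k + β zero * shiftUp q k
  where q = linearProduct d (α ∘ suc) (β ∘ suc)

linearProduct-degree : ∀ d α β k → d < k → linearProduct d α β k ≡ 0ℤ
linearProduct-degree zero    α β (suc k) _           = refl
linearProduct-degree (suc d) α β (suc k) (s≤s d<k) = cong₂ _+_
  (trans (cong (α zero *_) (linearProduct-degree d (α ∘ suc) (β ∘ suc) (suc k) (ℕ.m<n⇒m<1+n d<k))) (ℤ.*-zeroʳ (α zero)))
  (trans (cong (β zero *_) (linearProduct-degree d (α ∘ suc) (β ∘ suc) k d<k)) (ℤ.*-zeroʳ (β zero)))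

linearProduct-leading : ∀ d α β → linearProduct d α β d ≡ product β
linearProduct-leading zero    α β = refl
linearProduct-leading (suc d) α β = trans (cong₂ _+_
  (trans (cong (α zero *_) (linearProduct-degree d (α ∘ suc) (β ∘ suc) (suc d) (ℕ.n<1+n d))) (ℤ.*-zeroʳ (α zero)))
  (cong (β zero *_) (linearProduct-leading d (α ∘ suc) (β ∘ suc)))) (ℤ.+-identityˡ _)

eval-linearProduct : ∀ d α β x → eval (suc d) (linearProduct d α β) x ≡ product (λ i → α i + β i * x)
eval-linearProduct zero    α β x = refl
eval-linearProduct (suc d) α β x = begin
  eval (suc (suc d)) (linearProduct (suc d) α β) x
    ≡⟨ split ⟩
  a * eval (suc (suc d)) q x + b * eval (suc (suc d)) (shiftUp q) x
    ≡⟨ cong₂ (λ u w → a * u + b * w) (trans (∑ℕ-suc (suc d) (λ i → q i * x ^ i)) top) (eval-shiftUp (suc d) q x) ⟩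
  a * eval (suc d) q x + b * (x * eval (suc d) q x)
    ≡⟨ factor a b x _ ⟩
  (a + b * x) * eval (suc d) q x
    ≡⟨ cong ((a + b * x) *_) (eval-linearProduct d (α ∘ suc) (β ∘ suc) x) ⟩
  (a + b * x) * product (λ i → α (suc i) + β (suc i) * x) ∎
  where
  open ≡-Reasoning
  a = α zero
  b = β zero
  q = linearProduct d (α ∘ suc) (β ∘ suc)
  split : eval (suc (suc d)) (linearProduct (suc d) α β) x ≡ a * eval (suc (suc d)) q x + b * eval (suc (suc d)) (shiftUp q) x
  split = trans (sum-cong-≗ {suc (suc d)} (λ i → ℤ.*-distribʳ-+ (x ^ toℕ i) (a * q (toℕ i)) (b * shiftUp q (toℕ i))))
    (trans (∑-distrib-+ {suc (suc d)} (λ i → (a * q (toℕ i)) * x ^ toℕ i) (λ i → (b * shiftUp q (toℕ i)) * x ^ toℕ i))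
    (cong₂ _+_ (trans (sum-cong-≗ {suc (suc d)} (λ i → ℤ.*-assoc a (q (toℕ i)) (x ^ toℕ i))) (sym (*-distribˡ-sum {suc (suc d)} a (λ i → q (toℕ i) * x ^ toℕ i))))
               (trans (sum-cong-≗ {suc (suc d)} (λ i → ℤ.*-assoc b (shiftUp q (toℕ i)) (x ^ toℕ i))) (sym (*-distribˡ-sum {suc (suc d)} b (λ i → shiftUp q (toℕ i) * x ^ toℕ i))))))
  top : eval (suc d) q x + q (suc d) * x ^ suc d ≡ eval (suc d) q x
  top = trans (cong (λ t → eval (suc d) q x + t * x ^ suc d) (linearProduct-degree d (α ∘ suc) (β ∘ suc) (suc d) (ℕ.n<1+n d)))
              (trans (cong (_+_ (eval (suc d) q x)) (ℤ.*-zeroˡ (x ^ suc d))) (ℤ.+-identityʳ _))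
  factor : ∀ a b x e → a * e + b * (x * e) ≡ (a + b * x) * e
  factor = solve-∀

∣linearProduct∣≤ : ∀ d α β B → (∀ i → ∣ α i ∣ ≤ B) → (∀ i → ∣ β i ∣ ≤ B) → ∀ k → ∣ linearProduct d α β k ∣ ≤ 2 ℕ.^ d ℕ.* B ℕ.^ d
∣linearProduct∣≤ zero    α β B _ _ zero    = ℕ.≤-refl
∣linearProduct∣≤ zero    α β B _ _ (suc k) = z≤n
∣linearProduct∣≤ (suc d) α β B α≤B β≤B k = begin
  ∣ α zero * q k + β zero * shiftUp q k ∣
    ≤⟨ ℤ.∣i+j∣≤∣i∣+∣j∣ (α zero * q k) (β zero * shiftUp q k) ⟩
  ∣ α zero * q k ∣ ℕ.+ ∣ β zero * shiftUp q k ∣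
    ≡⟨ cong₂ ℕ._+_ (ℤ.abs-* (α zero) (q k)) (ℤ.abs-* (β zero) (shiftUp q k)) ⟩
  ∣ α zero ∣ ℕ.* ∣ q k ∣ ℕ.+ ∣ β zero ∣ ℕ.* ∣ shiftUp q k ∣
    ≤⟨ ℕ.+-mono-≤ (ℕ.*-mono-≤ (α≤B zero) (q≤ k)) (ℕ.*-mono-≤ (β≤B zero) (shifted≤ k)) ⟩
  B ℕ.* Q ℕ.+ B ℕ.* Q
    ≡⟨ double B (2 ℕ.^ d) (B ℕ.^ d) ⟩
  2 ℕ.^ suc d ℕ.* B ℕ.^ suc d ∎
  where
  open ℕ.≤-Reasoning
  q = linearProduct d (α ∘ suc) (β ∘ suc)
  Q = 2 ℕ.^ d ℕ.* B ℕ.^ d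
  q≤ : ∀ k → ∣ q k ∣ ≤ Q
  q≤ = ∣linearProduct∣≤ d (α ∘ suc) (β ∘ suc) B (α≤B ∘ suc) (β≤B ∘ suc)
  shifted≤ : ∀ k → ∣ shiftUp q k ∣ ≤ Q
  shifted≤ zero    = z≤n
  shifted≤ (suc k) = q≤ k
  double : ∀ B t b → B ℕ.* (t ℕ.* b) ℕ.+ B ℕ.* (t ℕ.* b) ≡ (2 ℕ.* t) ℕ.* (B ℕ.* b)
  double = solve-∀ℕ

charPoly : ∀ {n} → Matrix n → ℕ → ℤ
charPoly {n} M k = sumMaps n n (λ σ → sign σ * linearProduct n (λ i → - M (σ i) i) (λ i → δ (σ i) i) k)

module _ {n} (M : Matrix n) where

  private
    termPoly : (Fin n → Fin n) → ℕ → ℤ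
    termPoly σ = linearProduct n (λ i → - M (σ i) i) (λ i → δ (σ i) i)

  charPoly-eval : ∀ x → eval (suc n) (charPoly M) x ≡ det (λ r i → - M r i + δ r i * x)
  charPoly-eval x = begin
    ∑[ k < suc n ] (sumMaps n n (λ σ → sign σ * termPoly σ (toℕ k)) * x ^ toℕ k)
      ≡⟨ sum-cong-≗ {suc n} (λ k → sym (sumMaps-*ʳ n n (x ^ toℕ k) (λ σ → sign σ * termPoly σ (toℕ k)))) ⟩
    ∑[ k < suc n ] sumMaps n n (λ σ → (sign σ * termPoly σ (toℕ k)) * x ^ toℕ k)
      ≡⟨ sym (sumMaps-∑ n n (suc n) (λ σ k → (sign σ * termPoly σ (toℕ k)) * x ^ toℕ k)) ⟩
    sumMaps n n (λ σ → ∑[ k < suc n ] ((sign σ * termPoly σ (toℕ k)) * x ^ toℕ k))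
      ≡⟨ sumMaps-cong n n (λ σ → trans (sum-cong-≗ {suc n} (λ k → ℤ.*-assoc (sign σ) (termPoly σ (toℕ k)) (x ^ toℕ k)))
                                         (sym (*-distribˡ-sum {suc n} (sign σ) (λ k → termPoly σ (toℕ k) * x ^ toℕ k)))) ⟩
    sumMaps n n (λ σ → sign σ * eval (suc n) (termPoly σ) x)
      ≡⟨ sumMaps-cong n n (λ σ → cong (sign σ *_) (eval-linearProduct n (λ i → - M (σ i) i) (λ i → δ (σ i) i) x)) ⟩
    det (λ r i → - M r i + δ r i * x)
    ∎
    where open ≡-Reasoning

  charPoly-monic : charPoly M n ≡ 1ℤ
  charPoly-monic = trans (sumMaps-cong n n (λ σ → cong (sign σ *_) (linearProduct-leading n (λ i → - M (σ i) i) (λ i → δ (σ i) i))))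
                         (trans (sumMaps-δ n n sign sign-extensional (λ i → i)) (sign-id n))

  ∣charPoly∣≤ : ∀ {B} → 1 ≤ B → Bounded B M → ∀ k → ∣ charPoly M k ∣ ≤ n ℕ.^ n ℕ.* (2 ℕ.^ n ℕ.* B ℕ.^ n)
  ∣charPoly∣≤ {B} 1≤B M≤B k = ∣sumMaps∣≤ n n (λ σ → sign σ * termPoly σ k) (2 ℕ.^ n ℕ.* B ℕ.^ n) term≤
    where
    term≤ : ∀ σ → ∣ sign σ * termPoly σ k ∣ ≤ 2 ℕ.^ n ℕ.* B ℕ.^ n
    term≤ σ = ℕ.≤-trans (ℕ.≤-reflexive (ℤ.abs-* (sign σ) (termPoly σ k)))
      (ℕ.≤-trans (ℕ.*-mono-≤ (∣signum∣≤1 (vandermonde (λ i → + toℕ (σ i))))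
                             (∣linearProduct∣≤ n (λ i → - M (σ i) i) (λ i → δ (σ i) i) B
                                               (λ i → negate-bounded {A = M} M≤B (σ i) i) (λ i → ℕ.≤-trans (∣δ∣≤1 (σ i) i) 1≤B) k))
                 (ℕ.≤-reflexive (ℕ.+-identityʳ _)))

-- Block companion matrices

∣δℕ*∣≤ : ∀ a b z → ∣ δℕ a b * z ∣ ≤ ∣ z ∣
∣δℕ*∣≤ a b z = ℕ.≤-trans (ℕ.≤-reflexive (ℤ.abs-* (δℕ a b) z)) (ℕ.≤-trans (ℕ.*-monoˡ-≤ ∣ z ∣ (∣δℕ∣≤1 a b)) (ℕ.≤-reflexive (ℕ.+-identityʳ ∣ z ∣)))

∣δℕ*+δℕ*∣≤ : ∀ {a a' c c' b} y z → (a ≡ a' → c ≢ c') → ∣ y ∣ ≤ b → ∣ z ∣ ≤ b → ∣ δℕ a a' * y + δℕ c c' * z ∣ ≤ b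
∣δℕ*+δℕ*∣≤ {a} {a'} {c} {c'} {b} y z exclusive y≤b z≤b = by-cases (c ℕ.≟ c')
  where
  by-cases : Dec (c ≡ c') → ∣ δℕ a a' * y + δℕ c c' * z ∣ ≤ b
  by-cases (no c≢c') = subst (λ t → ∣ t ∣ ≤ b)
    (sym (trans (cong (_+_ (δℕ a a' * y)) (δℕ-off-* c≢c' z)) (ℤ.+-identityʳ (δℕ a a' * y))))
    (ℕ.≤-trans (∣δℕ*∣≤ a a' y) y≤b)
  by-cases (yes c≡c') = subst (λ t → ∣ t ∣ ≤ b)
    (sym (trans (cong (_+ δℕ c c' * z) (δℕ-off-* (λ a≡a' → exclusive a≡a' c≡c') y)) (ℤ.+-identityˡ (δℕ c c' * z))))
    (ℕ.≤-trans (∣δℕ*∣≤ c c' z) z≤b)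

-- Block matrix with w I on the block superdiagonal and −Op 0, …, −Op d as its last block row.
companion : ∀ d D → (Fin (suc d) → Matrix D) → ℤ → Matrix (suc d ℕ.* D)
companion d D Op w X Y = δℕ (toℕ s) (suc (toℕ r)) * (w * δ α β) + δℕ (toℕ r) d * - Op s α β
  where
  r = quotient {suc d} D X
  α = remainder {suc d} D X
  s = quotient {suc d} D Y
  β = remainder {suc d} D Y

companionVector : ∀ d D → ℤ → Vector ℤ D → Vector ℤ (suc d ℕ.* D)
companionVector d D x V Y = x ^ toℕ (quotient {suc d} D Y) * V (remainder {suc d} D Y)

companionVector-combine : ∀ d D x V (s : Fin (suc d)) (β : Fin D) → companionVector d D x V (combine s β) ≡ x ^ toℕ s * V β
companionVector-combine d D x V s β = cong₂ (λ s′ β′ → x ^ toℕ s′ * V β′) (quotient-combine s β) (remainder-combine s β)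

companion-bounded : ∀ d D Op w {b} → ∣ w ∣ ≤ b → (∀ s → Bounded b (Op s)) → Bounded b (companion d D Op w)
companion-bounded d D Op w {b} w≤b Op≤b X Y = ∣δℕ*+δℕ*∣≤ {toℕ s} {suc (toℕ r)} {toℕ r} {d} (w * δ α β) (- Op s α β)
  (λ s≡1+r r≡d → ℕ.<-irrefl (trans s≡1+r (cong suc r≡d)) (Fin.toℕ<n s))
  (ℕ.≤-trans (scalar-bounded w α β) w≤b) (negate-bounded {A = Op s} (Op≤b s) α β)
  where
  r = quotient {suc d} D X
  α = remainder {suc d} D X
  s = quotient {suc d} D Y
  β = remainder {suc d} D Y

module _ d D (Op : Fin (suc d) → Matrix D) (w x : ℤ) (V : Vector ℤ D) (X : Fin (suc d ℕ.* D)) where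

  private
    ρ = toℕ (quotient {suc d} D X)
    α = remainder {suc d} D X

  companion-*ᵥ : (companion d D Op w *ᵥ companionVector d D x V) X
               ≡ ∑[ s < suc d ] (δℕ (toℕ s) (suc ρ) * (w * (x ^ toℕ s * V α))) + δℕ ρ d * - ∑[ s < suc d ] (x ^ toℕ s * (Op s *ᵥ V) α)
  companion-*ᵥ = begin
    ∑[ Y < suc d ℕ.* D ] (C X Y * cv Y)
      ≡⟨ ∑-combine (suc d) D (λ Y → C X Y * cv Y) ⟩
    ∑[ s < suc d ] ∑[ β < D ] (C X (combine s β) * cv (combine s β))
      ≡⟨ sum-cong-≗ {suc d} block ⟩
    ∑[ s < suc d ] (δℕ (toℕ s) (suc ρ) * (w * (x ^ toℕ s * V α)) + δℕ ρ d * - (x ^ toℕ s * (Op s *ᵥ V) α))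
      ≡⟨ ∑-distrib-+ (λ s → δℕ (toℕ s) (suc ρ) * (w * (x ^ toℕ s * V α))) (λ s → δℕ ρ d * - (x ^ toℕ s * (Op s *ᵥ V) α)) ⟩
    ∑[ s < suc d ] (δℕ (toℕ s) (suc ρ) * (w * (x ^ toℕ s * V α))) + ∑[ s < suc d ] (δℕ ρ d * - (x ^ toℕ s * (Op s *ᵥ V) α))
      ≡⟨ cong (_+_ (∑[ s < suc d ] (δℕ (toℕ s) (suc ρ) * (w * (x ^ toℕ s * V α))))) last-row ⟩
    ∑[ s < suc d ] (δℕ (toℕ s) (suc ρ) * (w * (x ^ toℕ s * V α))) + δℕ ρ d * - ∑[ s < suc d ] (x ^ toℕ s * (Op s *ᵥ V) α)
    ∎
    where
    open ≡-Reasoning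
    C = companion d D Op w
    cv = companionVector d D x V
    entry : ∀ s β → C X (combine s β) * cv (combine s β)
                  ≡ δℕ (toℕ s) (suc ρ) * ((w * δ α β) * (x ^ toℕ s * V β)) + δℕ ρ d * - (x ^ toℕ s * (Op s α β * V β))
    entry s β = trans (cong₂ _*_ (cong₂ (λ s′ β′ → δℕ (toℕ s′) (suc ρ) * (w * δ α β′) + δℕ ρ d * - Op s′ α β′) (quotient-combine s β) (remainder-combine s β))
                                 (companionVector-combine d D x V s β))
                      (distribute (δℕ (toℕ s) (suc ρ)) (w * δ α β) (δℕ ρ d) (Op s α β) (x ^ toℕ s) (V β))
      where
      distribute : ∀ a e c o y v → (a * e + c * - o) * (y * v) ≡ a * (e * (y * v)) + c * - (y * (o * v))
      distribute = solve-∀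
    block : ∀ s → ∑[ β < D ] (C X (combine s β) * cv (combine s β))
                ≡ δℕ (toℕ s) (suc ρ) * (w * (x ^ toℕ s * V α)) + δℕ ρ d * - (x ^ toℕ s * (Op s *ᵥ V) α)
    block s = begin
      ∑[ β < D ] (C X (combine s β) * cv (combine s β))
        ≡⟨ sum-cong-≗ {D} (entry s) ⟩
      ∑[ β < D ] (a * ((w * δ α β) * f β) + c * - (x ^ toℕ s * (Op s α β * V β)))
        ≡⟨ ∑-distrib-+ {D} (λ β → a * ((w * δ α β) * f β)) (λ β → c * - (x ^ toℕ s * (Op s α β * V β))) ⟩
      ∑[ β < D ] (a * ((w * δ α β) * f β)) + ∑[ β < D ] (c * - (x ^ toℕ s * (Op s α β * V β)))
        ≡⟨ cong₂ _+_ (sym (*-distribˡ-sum {D} a (λ β → (w * δ α β) * f β))) (sym (*-distribˡ-sum {D} c (λ β → - (x ^ toℕ s * (Op s α β * V β))))) ⟩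
      a * (scalar w *ᵥ f) α + c * ∑[ β < D ] (- (x ^ toℕ s * (Op s α β * V β)))
        ≡⟨ cong₂ (λ t u → a * t + c * u) (scalar-*ᵥ w f α) (∑-neg (λ β → x ^ toℕ s * (Op s α β * V β))) ⟩
      a * (w * f α) + c * - ∑[ β < D ] (x ^ toℕ s * (Op s α β * V β))
        ≡⟨ cong (λ t → a * (w * f α) + c * - t) (sym (*-distribˡ-sum (x ^ toℕ s) (λ β → Op s α β * V β))) ⟩
      a * (w * f α) + c * - (x ^ toℕ s * (Op s *ᵥ V) α) ∎
      where
      a = δℕ (toℕ s) (suc ρ)
      c = δℕ ρ d
      f : Vector ℤ D
      f β = x ^ toℕ s * V β
    last-row : ∑[ s < suc d ] (δℕ ρ d * - (x ^ toℕ s * (Op s *ᵥ V) α)) ≡ δℕ ρ d * - ∑[ s < suc d ] (x ^ toℕ s * (Op s *ᵥ V) α)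
    last-row = trans (sym (*-distribˡ-sum {suc d} (δℕ ρ d) (λ s → - (x ^ toℕ s * (Op s *ᵥ V) α)))) (cong (δℕ ρ d *_) (∑-neg (λ s → x ^ toℕ s * (Op s *ᵥ V) α)))

-- Congruences modulo p

module Congruence (p : ℕ) where

  infix 4 _≈_
  record _≈_ (x y : ℤ) : Set where
    constructor by
    field
      multiplier : ℤ
      difference : x ≡ y + multiplier * + p

  ≈-refl : ∀ {x} → x ≈ x
  ≈-refl {x} = by 0ℤ (sym (trans (cong (_+_ x) (ℤ.*-zeroˡ (+ p))) (ℤ.+-identityʳ x)))

  ≈-reflexive : ∀ {x y} → x ≡ y → x ≈ y
  ≈-reflexive refl = ≈-refl

  ≈-sym : ∀ {x y} → x ≈ y → y ≈ x
  ≈-sym {y = y} (by q refl) = by (- q) (undo y q (+ p))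
    where
    undo : ∀ y q p → y ≡ (y + q * p) + (- q) * p
    undo = solve-∀

  ≈-trans : ∀ {x y z} → x ≈ y → y ≈ z → x ≈ z
  ≈-trans {z = z} (by q refl) (by q' refl) = by (q' + q) (regroup z q' q (+ p))
    where
    regroup : ∀ z q' q p → (z + q' * p) + q * p ≡ z + (q' + q) * p
    regroup = solve-∀

  ≈-setoid : Setoid _ _
  ≈-setoid = record { Carrier = ℤ ; _≈_ = _≈_ ; isEquivalence = record { refl = ≈-refl ; sym = ≈-sym ; trans = ≈-trans } }

  +-cong : ∀ {x x' y y'} → x ≈ x' → y ≈ y' → x + y ≈ x' + y'
  +-cong {x' = x'} {y' = y'} (by q refl) (by r refl) = by (q + r) (regroup x' y' q r (+ p))
    where
    regroup : ∀ x y q r p → (x + q * p) + (y + r * p) ≡ (x + y) + (q + r) * p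
    regroup = solve-∀

  *-cong : ∀ {x x' y y'} → x ≈ x' → y ≈ y' → x * y ≈ x' * y'
  *-cong {x' = x'} {y' = y'} (by q refl) (by r refl) = by (q * y' + x' * r + q * r * + p) (expand x' y' q r (+ p))
    where
    expand : ∀ x y q r p → (x + q * p) * (y + r * p) ≡ x * y + (q * y + x * r + q * r * p) * p
    expand = solve-∀

  -‿cong : ∀ {x x'} → x ≈ x' → - x ≈ - x'
  -‿cong {x' = x'} (by q refl) = by (- q) (negate-both x' q (+ p))
    where
    negate-both : ∀ x q p → - (x + q * p) ≡ - x + (- q) * p
    negate-both = solve-∀

  *-congˡ : ∀ x {y y'} → y ≈ y' → x * y ≈ x * y'
  *-congˡ x = *-cong (≈-refl {x})

  *-congʳ : ∀ y {x x'} → x ≈ x' → x * y ≈ x' * y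
  *-congʳ y x≈x' = *-cong x≈x' (≈-refl {y})

  Scales : ∀ {n} → Matrix n → ℤ → Vector ℤ n → Set
  Scales M λ′ v = ∀ r → (M *ᵥ v) r ≈ λ′ * v r

  ∑-cong : ∀ {n} {f g : Vector ℤ n} → (∀ i → f i ≈ g i) → sum f ≈ sum g
  ∑-cong {zero}  f≈g = ≈-refl
  ∑-cong {suc n} f≈g = +-cong (f≈g zero) (∑-cong (f≈g ∘ suc))

  sumMaps-cong-≈ : ∀ d n {g h : (Fin d → Fin n) → ℤ} → (∀ σ → g σ ≈ h σ) → sumMaps d n g ≈ sumMaps d n h
  sumMaps-cong-≈ zero    n g≈h = g≈h _
  sumMaps-cong-≈ (suc d) n g≈h = ∑-cong (λ a → sumMaps-cong-≈ d n (λ σ → g≈h (a ∷ σ)))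


  companion-scales : ∀ d D (Op : Fin (suc d) → Matrix D) w x (V : Vector ℤ D) →
                     (∀ α → ∑[ s < suc d ] (x ^ toℕ s * (Op s *ᵥ V) α) ≈ - (w * (x ^ suc d * V α))) →
                     Scales (companion d D Op w) (w * x) (companionVector d D x V)
  companion-scales d D Op w x V root X = ≈-trans (≈-reflexive (companion-*ᵥ d D Op w x V X)) (by-cases (ρ ℕ.≟ d))
    where
    ρ = toℕ (quotient {suc d} D X)
    α = remainder {suc d} D X
    shifted : Vector ℤ (suc d)
    shifted s = δℕ (toℕ s) (suc ρ) * (w * (x ^ toℕ s * V α))
    last : ℤ
    last = ∑[ s < suc d ] (x ^ toℕ s * (Op s *ᵥ V) α)
    regroup : ∀ w x y v → w * ((x * y) * v) ≡ (w * x) * (y * v)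
    regroup = solve-∀
    by-cases : Dec (ρ ≡ d) → sum shifted + δℕ ρ d * - last ≈ (w * x) * (x ^ ρ * V α)
    by-cases (yes ρ≡d) = begin
      sum shifted + δℕ ρ d * - last
        ≡⟨ cong₂ (λ t u → t + u * - last) (∑-zero shifted (λ s → δℕ-off-* (s≢1+d s) _)) (trans (cong (δℕ ρ) (sym ρ≡d)) (δℕ-diag ρ)) ⟩
      0ℤ + 1ℤ * - last
        ≡⟨ trans (ℤ.+-identityˡ _) (ℤ.*-identityˡ _) ⟩
      - last
        ≈⟨ -‿cong (root α) ⟩
      - - (w * (x ^ suc d * V α))
        ≡⟨ ℤ.neg-involutive _ ⟩
      w * (x ^ suc d * V α)
        ≡⟨ cong (λ t → w * (x ^ suc t * V α)) (sym ρ≡d) ⟩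
      w * (x ^ suc ρ * V α)
        ≡⟨ regroup w x (x ^ ρ) (V α) ⟩
      (w * x) * (x ^ ρ * V α) ∎
      where
      open ≈-Reasoning ≈-setoid
      s≢1+d : ∀ s → toℕ s ≢ suc ρ
      s≢1+d s s≡ = ℕ.<-irrefl (trans s≡ (cong suc ρ≡d)) (Fin.toℕ<n s)
    by-cases (no ρ≢d) = ≈-reflexive (begin
      sum shifted + δℕ ρ d * - last
        ≡⟨ cong (_+_ (sum shifted)) (δℕ-off-* ρ≢d (- last)) ⟩
      sum shifted + 0ℤ
        ≡⟨ ℤ.+-identityʳ _ ⟩
      sum shifted
        ≡⟨ ∑-single shifted next (λ s s≢next → δℕ-off-* (s≢next ∘ Fin.toℕ-injective ∘ flip trans (sym toℕ-next)) _) ⟩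
      shifted next
        ≡⟨ cong₂ (λ t u → t * (w * (x ^ u * V α))) (trans (cong (λ t → δℕ t (suc ρ)) toℕ-next) (δℕ-diag (suc ρ))) toℕ-next ⟩
      1ℤ * (w * (x ^ suc ρ * V α))
        ≡⟨ trans (ℤ.*-identityˡ _) (regroup w x (x ^ ρ) (V α)) ⟩
      (w * x) * (x ^ ρ * V α)         ∎)
      where
      open ≡-Reasoning
      ρ<d : ρ < d
      ρ<d = ℕ.≤∧≢⇒< (ℕ.≤-pred (Fin.toℕ<n (quotient {suc d} D X))) ρ≢d
      next : Fin (suc d)
      next = fromℕ< (s≤s ρ<d)
      toℕ-next : toℕ next ≡ suc ρ
      toℕ-next = Fin.toℕ-fromℕ< (s≤s ρ<d)

+∑ : ∀ n (f : Fin n → ℕ) → + ∑ n f ≡ ∑[ i < n ] (+ f i)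
+∑ zero    f = refl
+∑ (suc n) f = trans (ℤ.pos-+ (f zero) _) (cong (_+_ (+ f zero)) (+∑ n (f ∘ suc)))

+^ : ∀ x n → + (x ℕ.^ n) ≡ (+ x) ^ n
+^ x zero    = refl
+^ x (suc n) = trans (ℤ.pos-* x (x ℕ.^ n)) (cong (_*_ (+ x)) (+^ x n))

mod≡% : ∀ a p .{{_ : NonZero p}} → a mod p ≡ a ℕ.% p
mod≡% a (suc _) = refl

module Residues (p : ℕ) .{{_ : NonZero p}} where

  open Congruence p

  +%≈ : ∀ a → + (a ℕ.% p) ≈ + a
  +%≈ a = by (- + (a ℕ./ p)) (begin
    + (a ℕ.% p)                                         ≡⟨ undo (+ (a ℕ.% p)) (+ (a ℕ./ p)) (+ p) ⟩
    (+ (a ℕ.% p) + + (a ℕ./ p) * + p) + (- + (a ℕ./ p)) * + p ≡⟨ cong (λ t → t + (- + (a ℕ./ p)) * + p) (sym pos-div) ⟩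
    + a + (- + (a ℕ./ p)) * + p                         ∎)
    where
    open ≡-Reasoning
    undo : ∀ r q p → r ≡ (r + q * p) + (- q) * p
    undo = solve-∀
    pos-div : + a ≡ + (a ℕ.% p) + + (a ℕ./ p) * + p
    pos-div = trans (cong +_ (m≡m%n+[m/n]*n a p)) (trans (ℤ.pos-+ (a ℕ.% p) _) (cong (_+_ (+ (a ℕ.% p))) (ℤ.pos-* (a ℕ./ p) p)))

  +mod≈ : ∀ a → + (a mod p) ≈ + a
  +mod≈ a = subst (λ t → + t ≈ + a) (sym (mod≡% a p)) (+%≈ a)

  private
    nonneg-multiple : ∀ {a b} t → + a ≡ + b + + t * + p → a ℕ.% p ≡ b ℕ.% p
    nonneg-multiple {a} {b} t a≡ = trans (cong (ℕ._% p) (ℤ.+-injective (trans a≡ (trans (cong (_+_ (+ b)) (sym (ℤ.pos-* t p))) (sym (ℤ.pos-+ b (t ℕ.* p)))))))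
                                         ([m+kn]%n≡m%n b t p)

  ≈⇒%≡ : ∀ {a b} → + a ≈ + b → a ℕ.% p ≡ b ℕ.% p
  ≈⇒%≡ (by (+ t) a≡) = nonneg-multiple t a≡
  ≈⇒%≡ {a} {b} (by -[1+ t ] a≡) = sym (nonneg-multiple (suc t) (trans (shift (+ b) +[1+ t ] (+ p)) (cong (_+ +[1+ t ] * + p) (sym a≡))))
    where
    shift : ∀ b t p → b ≡ (b + (- t) * p) + t * p
    shift = solve-∀

  ≈⇒mod≡ : ∀ {a b} → + a ≈ + b → a mod p ≡ b mod p
  ≈⇒mod≡ {a} {b} a≈b = trans (mod≡% a p) (trans (≈⇒%≡ a≈b) (sym (mod≡% b p)))

  <p-≈⇒≡ : ∀ {a b} → a < p → b < p → + a ≈ + b → a ≡ b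
  <p-≈⇒≡ a<p b<p a≈b = trans (sym (m<n⇒m%n≡m a<p)) (trans (≈⇒%≡ a≈b) (m<n⇒m%n≡m b<p))

  residue : ℤ → ℕ
  residue z = z ℤ.%ℕ p

  residue<p : ∀ z → residue z < p
  residue<p z = n%ℕd<d z p

  residue≈ : ∀ z → + residue z ≈ z
  residue≈ z = ≈-sym (by (z ℤ./ℕ p) (a≡a%ℕn+[a/ℕn]*n z p))

  absF-residue≤ : ∀ z → absF p (residue z) ≤ ∣ z ∣
  absF-residue≤ (+ n) = ℕ.≤-trans (ℕ.m⊓n≤m (n ℕ.% p) _) (m%n≤m n p)
  absF-residue≤ -[1+ n ] with suc n ℕ.% p in r≡
  ... | zero       = z≤n
  ... | r@(suc _)  = ℕ.≤-trans (ℕ.m⊓n≤n (p ℕ.∸ r) _)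
                     (ℕ.≤-trans (ℕ.≤-reflexive (ℕ.m∸[m∸n]≡n (ℕ.<⇒≤ (subst (_< p) r≡ (m%n<n (suc n) p)))))
                                (subst (_≤ suc n) r≡ (m%n≤m (suc n) p)))

  signedRep : ℕ → ℤ
  signedRep e with e ℕ.≤? p ℕ.∸ e
  ... | yes _ = + e
  ... | no  _ = - + (p ℕ.∸ e)

  ∣signedRep∣≤absF : ∀ e → ∣ signedRep e ∣ ≤ absF p e
  ∣signedRep∣≤absF e with e ℕ.≤? p ℕ.∸ e
  ... | yes e≤ = ℕ.≤-reflexive (sym (ℕ.m≤n⇒m⊓n≡m e≤))
  ... | no  e≰ = ℕ.≤-reflexive (trans (ℤ.∣-i∣≡∣i∣ (+ (p ℕ.∸ e))) (sym (ℕ.m≥n⇒m⊓n≡n (ℕ.≰⇒≥ e≰))))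

  signedRep≈ : ∀ {e} → e ≤ p → signedRep e ≈ + e
  signedRep≈ {e} e≤p with e ℕ.≤? p ℕ.∸ e
  ... | yes _ = ≈-refl
  ... | no  _ = by (- 1ℤ) (begin
    - + (p ℕ.∸ e)       ≡⟨ cong -_ (trans (sym (ℤ.⊖-≥ e≤p)) (sym (ℤ.m-n≡m⊖n p e))) ⟩
    - (+ p - + e)       ≡⟨ rearrange (+ p) (+ e) ⟩
    + e + - 1ℤ * + p    ∎)
    where
    open ≡-Reasoning
    rearrange : ∀ p e → - (p - e) ≡ e + - 1ℤ * p
    rearrange = solve-∀

  ≈0⇒∣ : ∀ {x} → x ≈ 0ℤ → p ∣ ∣ x ∣
  ≈0⇒∣ {x} (by q x≡) = divides ∣ q ∣ (trans (cong ∣_∣ (trans x≡ (ℤ.+-identityˡ (q * + p)))) (ℤ.abs-* q (+ p)))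

  ∣⇒≈0 : ∀ {x} → p ∣ ∣ x ∣ → x ≈ 0ℤ
  ∣⇒≈0 {+ n}      (divides t n≡) = by (+ t) (trans (cong +_ n≡) (trans (ℤ.pos-* t p) (sym (ℤ.+-identityˡ _))))
  ∣⇒≈0 { -[1+ n ]} (divides t n≡) = by (- + t) (trans (cong (λ m → - + m) n≡) (trans (cong -_ (ℤ.pos-* t p)) (negate-product (+ t) (+ p))))
    where
    negate-product : ∀ t p → - (t * p) ≡ 0ℤ + (- t) * p
    negate-product = solve-∀

  ≈0? : ∀ x → Dec (x ≈ 0ℤ)
  ≈0? x with residue x ℕ.≟ 0
  ... | yes r≡0 = yes (≈-trans (≈-sym (residue≈ x)) (≈-reflexive (cong +_ r≡0)))
  ... | no  r≢0 = no (λ x≈0 → r≢0 (<p-≈⇒≡ (residue<p x) (ℕ.>-nonZero⁻¹ p) (≈-trans (residue≈ x) x≈0)))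

  leastNonzero : ∀ (c : ℕ → ℤ) n → ¬ c n ≈ 0ℤ → Σ ℕ λ j → j ≤ n × ¬ c j ≈ 0ℤ × (∀ i → i < j → c i ≈ 0ℤ)
  leastNonzero c zero    c0≉0 = 0 , z≤n , c0≉0 , λ _ ()
  leastNonzero c (suc n) cn≉0 with ≈0? (c 0)
  ... | no  c0≉0 = 0 , z≤n , c0≉0 , λ _ ()
  ... | yes c0≈0 with leastNonzero (c ∘ suc) n cn≉0
  ...   | j , j≤n , cj≉0 , below = suc j , s≤s j≤n , cj≉0 , λ { zero _ → c0≈0 ; (suc i) (s≤s i<j) → below i i<j }

-- Certificates

module PrimeField {p : ℕ} (p-prime : Prime p) where

  private instance
    p-nonZero : NonZero p
    p-nonZero = prime⇒nonZero p-prime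

  open Congruence p
  open Residues p

  *≈0⇒≈0⊎≈0 : ∀ {x y} → x * y ≈ 0ℤ → x ≈ 0ℤ ⊎ y ≈ 0ℤ
  *≈0⇒≈0⊎≈0 {x} {y} xy≈0 = Sum.map ∣⇒≈0 ∣⇒≈0 (euclidsLemma ∣ x ∣ ∣ y ∣ p-prime (subst (p ∣_) (ℤ.abs-* x y) (≈0⇒∣ xy≈0)))

  *-≉0 : ∀ {x y} → ¬ x ≈ 0ℤ → ¬ y ≈ 0ℤ → ¬ x * y ≈ 0ℤ
  *-≉0 x≉0 y≉0 xy≈0 = Sum.[ x≉0 , y≉0 ] (*≈0⇒≈0⊎≈0 xy≈0)

  1≉0 : ¬ 1ℤ ≈ 0ℤ
  1≉0 1≈0 = ¬prime[1] (subst Prime (∣1⇒≡1 (≈0⇒∣ 1≈0)) p-prime)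

  inverse : ∀ x → ¬ x ≈ 0ℤ → Σ ℤ λ y → x * y ≈ 1ℤ
  inverse x x≉0 with residue x in r≡
  ... | zero    = ⊥-elim (x≉0 (≈-trans (≈-sym (residue≈ x)) (≈-reflexive (cong +_ r≡))))
  ... | r@(suc _) = Σ.map₂ (≈-trans (*-congʳ _ x≈r)) (bézout (coprime-Bézout (prime⇒coprime p-prime (subst (_< p) r≡ (residue<p x)))))
    where
    x≈r : x ≈ + r
    x≈r = ≈-trans (≈-sym (residue≈ x)) (≈-reflexive (cong +_ r≡))
    bézout : Bézout.Identity 1 p r → Σ ℤ λ y → + r * y ≈ 1ℤ
    bézout (Bézout.+- a b 1+br≡ap) = - + b , by (- + a) (begin
      + r * - + b
        ≡⟨ rearrange (+ r) (+ b) ⟩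
      1ℤ - (1ℤ + + b * + r)
        ≡⟨ cong (λ t → 1ℤ - t) (trans (cong (_+_ 1ℤ) (sym (ℤ.pos-* b r))) (trans (sym (ℤ.pos-+ 1 (b ℕ.* r))) (trans (cong +_ 1+br≡ap) (ℤ.pos-* a p)))) ⟩
      1ℤ - + a * + p
        ≡⟨ cong (_+_ 1ℤ) (ℤ.neg-distribˡ-* (+ a) (+ p)) ⟩
      1ℤ + - + a * + p        ∎)
      where
      open ≡-Reasoning
      rearrange : ∀ r b → r * - b ≡ 1ℤ - (1ℤ + b * r)
      rearrange = solve-∀
    bézout (Bézout.-+ a b 1+ap≡br) = + b , by (+ a) (begin
      + r * + b           ≡⟨ ℤ.*-comm (+ r) (+ b) ⟩
      + b * + r           ≡⟨ ℤ.pos-* b r ⟨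
      + (b ℕ.* r)         ≡⟨ cong +_ 1+ap≡br ⟨
      + (1 ℕ.+ a ℕ.* p)   ≡⟨ trans (ℤ.pos-+ 1 (a ℕ.* p)) (cong (_+_ 1ℤ) (ℤ.pos-* a p)) ⟩
      1ℤ + + a * + p      ∎)
      where open ≡-Reasoning

  record Certificate (x : ℤ) : Set where
    field
      dim        : ℕ
      matrix     : Matrix dim
      bound      : ℕ
      bounded    : Bounded bound matrix
      scale      : ℕ
      scale≉0    : ¬ + scale ≈ 0ℤ
      vector     : Vector ℤ dim
      support    : Fin dim
      support≉0  : ¬ vector support ≈ 0ℤ
      scales     : Scales matrix (+ scale * x) vector

    size : ℕ
    size = dim ℕ.+ ⌈log₂ (bound ⊔ scale) ⌉

    1≤dim : 1 ≤ dim
    1≤dim = ℕ.>-nonZero⁻¹ dim {{Fin.nonZeroIndex support}}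

  open Certificate using (size)

  achieves : ∀ {y} x (w : Certificate y) → y ≈ + x → Achieves p x (size w)
  achieves {y} x w y≈x = dim , bound , scale , 1≤dim , scale-mod≢0
                       , (M , (λ r c → residue<p (matrix r c) , ℕ.≤-trans (absF-residue≤ (matrix r c)) (bounded r c))
                            , (v , (λ j → residue<p (vector j)) , v≢0 , eigen))
                       , refl
    where
    open Certificate w
    M : Fin dim → Fin dim → ℕ
    M r c = residue (matrix r c)
    v : Fin dim → ℕ
    v j = residue (vector j)
    scale-mod≢0 : scale mod p ≢ 0
    scale-mod≢0 k≡0 = scale≉0 (≈-trans (≈-sym (+mod≈ scale)) (≈-reflexive (cong +_ k≡0)))
    v≢0 : ¬ (∀ j → v j ≡ 0)
    v≢0 v≡0 = support≉0 (≈-trans (≈-sym (residue≈ (vector support))) (≈-reflexive (cong +_ (v≡0 support))))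
    eigen : ∀ r → ∑ dim (λ c → M r c ℕ.* v c) mod p ≡ ((scale ℕ.* x) mod p ℕ.* v r) mod p
    eigen r = ≈⇒mod≡ (begin
      + ∑ dim (λ c → M r c ℕ.* v c)             ≡⟨ +∑ dim (λ c → M r c ℕ.* v c) ⟩
      ∑[ c < dim ] (+ (M r c ℕ.* v c))          ≈⟨ ∑-cong (λ c → ≈-trans (≈-reflexive (ℤ.pos-* (M r c) (v c))) (*-cong (residue≈ (matrix r c)) (residue≈ (vector c)))) ⟩
      (matrix *ᵥ vector) r                      ≈⟨ scales r ⟩
      (+ scale * y) * vector r                  ≈⟨ *-cong (*-congˡ (+ scale) y≈x) (≈-sym (residue≈ (vector r))) ⟩
      (+ scale * + x) * + v r                   ≈⟨ *-congʳ (+ v r) (≈-trans (≈-reflexive (sym (ℤ.pos-* scale x))) (≈-sym (+mod≈ (scale ℕ.* x)))) ⟩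
      + ((scale ℕ.* x) mod p) * + v r           ≡⟨ ℤ.pos-* ((scale ℕ.* x) mod p) (v r) ⟨
      + ((scale ℕ.* x) mod p ℕ.* v r)           ∎)
      where open ≈-Reasoning ≈-setoid

  certificate : ∀ {x c} → Achieves p x c → Σ (Certificate (+ x)) (λ w → size w ≡ c)
  certificate {x} (n , m , k , 1≤n , k-mod≢0 , (M , M-bounded , (v , v<p , v≢0 , eigen)) , refl) = w , refl
    where
    nonzero-entry : Σ (Fin n) λ j → v j ≢ 0
    nonzero-entry = Fin.¬∀⟶∃¬ n (λ j → v j ≡ 0) (λ j → v j ℕ.≟ 0) v≢0
    support : Fin n
    support = Σ.proj₁ nonzero-entry
    v[support]≢0 : v support ≢ 0
    v[support]≢0 = Σ.proj₂ nonzero-entry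
    w : Certificate (+ x)
    w = record
      { dim = n ; matrix = λ r c → signedRep (M r c) ; bound = m
      ; bounded = λ r c → ℕ.≤-trans (∣signedRep∣≤absF (M r c)) (Σ.proj₂ (M-bounded r c))
      ; scale = k ; scale≉0 = λ k≈0 → k-mod≢0 (trans (≈⇒mod≡ k≈0) (trans (mod≡% 0 p) (m<n⇒m%n≡m (ℕ.>-nonZero⁻¹ p))))
      ; vector = λ j → + v j ; support = support
      ; support≉0 = λ v≈0 → v[support]≢0 (<p-≈⇒≡ (v<p support) (ℕ.>-nonZero⁻¹ p) v≈0)
      ; scales = λ r → begin
          ∑[ c < n ] (signedRep (M r c) * + v c)   ≈⟨ ∑-cong (λ c → *-congʳ (+ v c) (signedRep≈ (ℕ.<⇒≤ (Σ.proj₁ (M-bounded r c))))) ⟩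
          ∑[ c < n ] (+ M r c * + v c)             ≡⟨ sum-cong-≗ {n} (λ c → ℤ.pos-* (M r c) (v c)) ⟨
          ∑[ c < n ] (+ (M r c ℕ.* v c))           ≡⟨ +∑ n (λ c → M r c ℕ.* v c) ⟨
          + ∑ n (λ c → M r c ℕ.* v c)              ≈⟨ ≈-sym (+mod≈ _) ⟩
          + (∑ n (λ c → M r c ℕ.* v c) mod p)      ≡⟨ cong +_ (eigen r) ⟩
          + (((k ℕ.* x) mod p ℕ.* v r) mod p)      ≈⟨ +mod≈ _ ⟩
          + ((k ℕ.* x) mod p ℕ.* v r)              ≡⟨ ℤ.pos-* ((k ℕ.* x) mod p) (v r) ⟩
          + ((k ℕ.* x) mod p) * + v r              ≈⟨ *-congʳ (+ v r) (≈-trans (+mod≈ (k ℕ.* x)) (≈-reflexive (ℤ.pos-* k x))) ⟩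
          (+ k * + x) * + v r                      ∎ }
      where open ≈-Reasoning ≈-setoid

  minimal : ∀ {x c y} → IsF p x c → (w : Certificate y) → y ≈ + x → c ≤ size w
  minimal (_ , least) w y≈x = least _ (achieves _ w y≈x)

  ⊗ᵥ-≉0 : ∀ {m n} (v : Vector ℤ m) (w : Vector ℤ n) {i j} → ¬ v i ≈ 0ℤ → ¬ w j ≈ 0ℤ → ¬ (v ⊗ᵥ w) (combine i j) ≈ 0ℤ
  ⊗ᵥ-≉0 v w {i} {j} vi≉0 wj≉0 = *-≉0 vi≉0 wj≉0 ∘ ≈-trans (≈-reflexive (sym (⊗ᵥ-combine v w i j)))

  +*-≉0 : ∀ {k l} → ¬ + k ≈ 0ℤ → ¬ + l ≈ 0ℤ → ¬ + (k ℕ.* l) ≈ 0ℤ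
  +*-≉0 {k} {l} k≉0 l≉0 = *-≉0 k≉0 l≉0 ∘ ≈-trans (≈-reflexive (sym (ℤ.pos-* k l)))

  negateCertificate : ∀ {a} → Certificate a → Certificate (- a)
  negateCertificate {a} w = record
    { dim = dim ; matrix = negate matrix ; bound = bound ; bounded = negate-bounded {A = matrix} bounded
    ; scale = scale ; scale≉0 = scale≉0 ; vector = vector ; support = support ; support≉0 = support≉0
    ; scales = λ r → begin
        (negate matrix *ᵥ vector) r   ≡⟨ negate-*ᵥ matrix vector r ⟩
        - (matrix *ᵥ vector) r        ≈⟨ -‿cong (scales r) ⟩
        - ((+ scale * a) * vector r)  ≡⟨ move-sign (+ scale) a (vector r) ⟩
        (+ scale * - a) * vector r    ∎ }
    where
    open Certificate w
    open ≈-Reasoning ≈-setoid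
    move-sign : ∀ k a v → - ((k * a) * v) ≡ (k * - a) * v
    move-sign = solve-∀

  multiplyCertificate : ∀ {a b} → Certificate a → Certificate b → Certificate (a * b)
  multiplyCertificate {a} {b} wa wb = record
    { dim = A.dim ℕ.* B.dim ; matrix = A.matrix ⊗ B.matrix
    ; bound = A.bound ℕ.* B.bound ; bounded = ⊗-bounded {A = A.matrix} {B.matrix} A.bounded B.bounded
    ; scale = A.scale ℕ.* B.scale ; scale≉0 = +*-≉0 A.scale≉0 B.scale≉0
    ; vector = A.vector ⊗ᵥ B.vector ; support = combine A.support B.support
    ; support≉0 = ⊗ᵥ-≉0 A.vector B.vector A.support≉0 B.support≉0
    ; scales = λ X → let i = quotient B.dim X ; j = remainder {A.dim} B.dim X in begin
        ((A.matrix ⊗ B.matrix) *ᵥ (A.vector ⊗ᵥ B.vector)) X              ≡⟨ ⊗-*ᵥ-⊗ᵥ A.matrix B.matrix A.vector B.vector X ⟩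
        (A.matrix *ᵥ A.vector) i * (B.matrix *ᵥ B.vector) j              ≈⟨ *-cong (A.scales i) (B.scales j) ⟩
        ((+ A.scale * a) * A.vector i) * ((+ B.scale * b) * B.vector j)  ≡⟨ rearrange (+ A.scale) a (A.vector i) (+ B.scale) b (B.vector j) ⟩
        ((+ A.scale * + B.scale) * (a * b)) * (A.vector ⊗ᵥ B.vector) X   ≡⟨ cong (λ t → (t * (a * b)) * (A.vector ⊗ᵥ B.vector) X) (ℤ.pos-* A.scale B.scale) ⟨
        (+ (A.scale ℕ.* B.scale) * (a * b)) * (A.vector ⊗ᵥ B.vector) X   ∎ }
    where
    module A = Certificate wa
    module B = Certificate wb
    open ≈-Reasoning ≈-setoid
    rearrange : ∀ k a v l b w → ((k * a) * v) * ((l * b) * w) ≡ ((k * l) * (a * b)) * (v * w)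
    rearrange = solve-∀

  size-multiplyCertificate : ∀ {a b} (wa : Certificate a) (wb : Certificate b) → size (multiplyCertificate wa wb) ≤ size wa ℕ.* size wb
  size-multiplyCertificate wa wb = ℕ.≤-trans (ℕ.+-monoʳ-≤ (A.dim ℕ.* B.dim) log≤)
    (m*n+[k+l]≤[m+k]*[n+l] La Lb A.1≤dim B.1≤dim)
    where
    module A = Certificate wa
    module B = Certificate wb
    La = ⌈log₂ (A.bound ⊔ A.scale) ⌉
    Lb = ⌈log₂ (B.bound ⊔ B.scale) ⌉
    log≤ : ⌈log₂ (A.bound ℕ.* B.bound ⊔ A.scale ℕ.* B.scale) ⌉ ≤ La ℕ.+ Lb
    log≤ = n≤2^e⇒⌈log₂n⌉≤e (La ℕ.+ Lb) (ℕ.⊔-lub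
      (ℕ.≤-trans (ℕ.*-mono-≤ (Σ.proj₁ (⊔≤2^⌈log₂⊔⌉ A.bound A.scale)) (Σ.proj₁ (⊔≤2^⌈log₂⊔⌉ B.bound B.scale))) (ℕ.≤-reflexive (sym (ℕ.^-distribˡ-+-* 2 La Lb))))
      (ℕ.≤-trans (ℕ.*-mono-≤ (Σ.proj₂ (⊔≤2^⌈log₂⊔⌉ A.bound A.scale)) (Σ.proj₂ (⊔≤2^⌈log₂⊔⌉ B.bound B.scale))) (ℕ.≤-reflexive (sym (ℕ.^-distribˡ-+-* 2 La Lb)))))

  record JointCertificate {N} (a : Fin N → ℤ) (dim bound : ℕ) : Set where
    field
      matrix      : Fin N → Matrix dim
      bounded     : ∀ j → Bounded bound (matrix j)
      scale       : ℕ
      scale≉0     : ¬ + scale ≈ 0ℤ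
      scale≤bound : scale ≤ bound
      vector      : Vector ℤ dim
      support     : Fin dim
      support≉0   : ¬ vector support ≈ 0ℤ
      scales      : ∀ j → Scales (matrix j) (+ scale * a j) vector

  module _ {N} {a : Fin N → ℤ} (ws : ∀ j → Certificate (a j)) where
    open Certificate

    jointDim : ℕ
    jointDim = ∏ N (λ j → dim (ws j))

    jointBound : ℕ
    jointBound = ∏ N (λ j → bound (ws j) ⊔ scale (ws j))

    logHeight : Fin N → ℕ
    logHeight j = ⌈log₂ (bound (ws j) ⊔ scale (ws j)) ⌉

    jointBound≤2^∑ : jointBound ≤ 2 ℕ.^ ∑ N logHeight
    jointBound≤2^∑ = ∏≤2^∑ N (λ j → bound (ws j) ⊔ scale (ws j)) logHeight (λ j → n≤2^⌈log₂n⌉ _)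

    jointDim+∑≤∏size : jointDim ℕ.+ ∑ N logHeight ≤ ∏ N (λ j → size (ws j))
    jointDim+∑≤∏size = ∏+∑≤∏+ N (λ j → dim (ws j)) logHeight (λ j → 1≤dim (ws j))

  -- The vector is v₀ ⊗ v₁ ⊗ ⋯; matrix j acts as M_j on the j-th factor and as the scale k_i on the others.
  jointCertificate : ∀ N {a : Fin N → ℤ} (ws : ∀ j → Certificate (a j)) → JointCertificate a (jointDim ws) (jointBound ws)
  jointCertificate zero ws = record
    { matrix = λ () ; bounded = λ () ; scale = 1 ; scale≉0 = 1≉0 ; scale≤bound = ℕ.≤-refl
    ; vector = λ _ → 1ℤ ; support = zero ; support≉0 = 1≉0 ; scales = λ () }
  jointCertificate (suc N) {a} ws = record
    { matrix = matrix ; bounded = bounded ; scale = w.scale ℕ.* J.scale ; scale≉0 = +*-≉0 w.scale≉0 J.scale≉0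
    ; scale≤bound = ℕ.*-mono-≤ (ℕ.m≤n⊔m w.bound w.scale) J.scale≤bound
    ; vector = w.vector ⊗ᵥ J.vector ; support = combine w.support J.support
    ; support≉0 = ⊗ᵥ-≉0 w.vector J.vector w.support≉0 J.support≉0 ; scales = scales }
    where
    module w = Certificate (ws zero)
    module J = JointCertificate (jointCertificate N (ws ∘ suc))
    D = jointDim (ws ∘ suc)
    B = jointBound (ws ∘ suc)
    matrix : Fin (suc N) → Matrix (w.dim ℕ.* D)
    matrix zero    = w.matrix ⊗ scalar {D} (+ J.scale)
    matrix (suc j) = scalar {w.dim} (+ w.scale) ⊗ J.matrix j
    bounded : ∀ j → Bounded ((w.bound ⊔ w.scale) ℕ.* B) (matrix j)
    bounded zero    r c = ℕ.≤-trans (⊗-bounded {A = w.matrix} {scalar {D} (+ J.scale)} w.bounded (scalar-bounded {D} (+ J.scale)) r c)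
                                    (ℕ.*-mono-≤ (ℕ.m≤m⊔n w.bound w.scale) J.scale≤bound)
    bounded (suc j) r c = ℕ.≤-trans (⊗-bounded {A = scalar {w.dim} (+ w.scale)} {J.matrix j} (scalar-bounded {w.dim} (+ w.scale)) (J.bounded j) r c)
                                    (ℕ.*-monoˡ-≤ B (ℕ.m≤n⊔m w.bound w.scale))
    open ≈-Reasoning ≈-setoid
    scales : ∀ j → Scales (matrix j) (+ (w.scale ℕ.* J.scale) * a j) (w.vector ⊗ᵥ J.vector)
    scales zero X = let i = quotient D X ; l = remainder {w.dim} D X in begin
      (matrix zero *ᵥ (w.vector ⊗ᵥ J.vector)) X                      ≡⟨ ⊗-*ᵥ-⊗ᵥ w.matrix (scalar {D} (+ J.scale)) w.vector J.vector X ⟩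
      (w.matrix *ᵥ w.vector) i * (scalar {D} (+ J.scale) *ᵥ J.vector) l  ≡⟨ cong ((w.matrix *ᵥ w.vector) i *_) (scalar-*ᵥ (+ J.scale) J.vector l) ⟩
      (w.matrix *ᵥ w.vector) i * (+ J.scale * J.vector l)            ≈⟨ *-congʳ (+ J.scale * J.vector l) (w.scales i) ⟩
      ((+ w.scale * a zero) * w.vector i) * (+ J.scale * J.vector l) ≡⟨ rearrange (+ w.scale) (a zero) (w.vector i) (+ J.scale) (J.vector l) ⟩
      ((+ w.scale * + J.scale) * a zero) * (w.vector ⊗ᵥ J.vector) X  ≡⟨ cong (λ t → (t * a zero) * (w.vector ⊗ᵥ J.vector) X) (ℤ.pos-* w.scale J.scale) ⟨
      (+ (w.scale ℕ.* J.scale) * a zero) * (w.vector ⊗ᵥ J.vector) X  ∎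
      where
      rearrange : ∀ k a v K V → ((k * a) * v) * (K * V) ≡ ((k * K) * a) * (v * V)
      rearrange = solve-∀
    scales (suc j) X = let i = quotient D X ; l = remainder {w.dim} D X in begin
      (matrix (suc j) *ᵥ (w.vector ⊗ᵥ J.vector)) X                       ≡⟨ ⊗-*ᵥ-⊗ᵥ (scalar {w.dim} (+ w.scale)) (J.matrix j) w.vector J.vector X ⟩
      (scalar {w.dim} (+ w.scale) *ᵥ w.vector) i * (J.matrix j *ᵥ J.vector) l    ≡⟨ cong (_* (J.matrix j *ᵥ J.vector) l) (scalar-*ᵥ (+ w.scale) w.vector i) ⟩
      (+ w.scale * w.vector i) * (J.matrix j *ᵥ J.vector) l              ≈⟨ *-congˡ (+ w.scale * w.vector i) (J.scales j l) ⟩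
      (+ w.scale * w.vector i) * ((+ J.scale * a (suc j)) * J.vector l)  ≡⟨ rearrange (+ w.scale) (w.vector i) (+ J.scale) (a (suc j)) (J.vector l) ⟩
      ((+ w.scale * + J.scale) * a (suc j)) * (w.vector ⊗ᵥ J.vector) X   ≡⟨ cong (λ t → (t * a (suc j)) * (w.vector ⊗ᵥ J.vector) X) (ℤ.pos-* w.scale J.scale) ⟨
      (+ (w.scale ℕ.* J.scale) * a (suc j)) * (w.vector ⊗ᵥ J.vector) X   ∎
      where
      rearrange : ∀ k v K a V → (k * v) * ((K * a) * V) ≡ ((k * K) * a) * (v * V)
      rearrange = solve-∀

  pairCertificates : ∀ {a b} → Certificate a → Certificate b → ∀ j → Certificate ((a ∷ b ∷ []) j)
  pairCertificates wa wb zero       = wa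
  pairCertificates wa wb (suc zero) = wb

  addCertificate : ∀ {a b} → Certificate a → Certificate b → Certificate (a + b)
  addCertificate {a} {b} wa wb = record
    { dim = jointDim ws ; matrix = M ; bound = 2 ℕ.* jointBound ws
    ; bounded = λ r c → ℕ.≤-trans (ℤ.∣i+j∣≤∣i∣+∣j∣ (J.matrix zero r c) _)
                          (ℕ.≤-trans (ℕ.+-mono-≤ (J.bounded zero r c) (J.bounded (suc zero) r c))
                                     (ℕ.≤-reflexive (cong (jointBound ws ℕ.+_) (sym (ℕ.+-identityʳ (jointBound ws))))))
    ; scale = J.scale ; scale≉0 = J.scale≉0 ; vector = J.vector ; support = J.support ; support≉0 = J.support≉0
    ; scales = λ r → begin
        (M *ᵥ J.vector) r
          ≡⟨ sum-cong-≗ {jointDim ws} (λ c → ℤ.*-distribʳ-+ (J.vector c) (J.matrix zero r c) _) ⟩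
        ∑[ c < jointDim ws ] (J.matrix zero r c * J.vector c + J.matrix (suc zero) r c * J.vector c)
          ≡⟨ ∑-distrib-+ (λ c → J.matrix zero r c * J.vector c) (λ c → J.matrix (suc zero) r c * J.vector c) ⟩
        (J.matrix zero *ᵥ J.vector) r + (J.matrix (suc zero) *ᵥ J.vector) r
          ≈⟨ +-cong (J.scales zero r) (J.scales (suc zero) r) ⟩
        (+ J.scale * a) * J.vector r + (+ J.scale * b) * J.vector r
          ≡⟨ factor (+ J.scale) a b (J.vector r) ⟩
        (+ J.scale * (a + b)) * J.vector r                                 ∎ }
    where
    ws = pairCertificates wa wb
    module J = JointCertificate (jointCertificate 2 ws)
    M : Matrix (jointDim ws)
    M r c = J.matrix zero r c + J.matrix (suc zero) r c
    open ≈-Reasoning ≈-setoid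
    factor : ∀ k a b v → (k * a) * v + (k * b) * v ≡ (k * (a + b)) * v
    factor = solve-∀

  size-addCertificate : ∀ {a b} (wa : Certificate a) (wb : Certificate b) → size (addCertificate wa wb) ≤ size wa ℕ.* size wb ℕ.+ 1
  size-addCertificate wa wb = begin
    jointDim ws ℕ.+ ⌈log₂ (2 ℕ.* jointBound ws ⊔ J.scale) ⌉   ≤⟨ ℕ.+-monoʳ-≤ (jointDim ws) log≤ ⟩
    jointDim ws ℕ.+ suc S                                     ≡⟨ ℕ.+-suc (jointDim ws) S ⟩
    suc (jointDim ws ℕ.+ S)                                   ≤⟨ s≤s (jointDim+∑≤∏size ws) ⟩
    suc (size wa ℕ.* (size wb ℕ.* 1))                         ≡⟨ cong (λ t → suc (size wa ℕ.* t)) (ℕ.*-identityʳ (size wb)) ⟩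
    suc (size wa ℕ.* size wb)                                 ≡⟨ ℕ.+-comm 1 _ ⟩
    size wa ℕ.* size wb ℕ.+ 1                                 ∎
    where
    open ℕ.≤-Reasoning
    ws = pairCertificates wa wb
    module J = JointCertificate (jointCertificate 2 ws)
    S = ∑ 2 (logHeight ws)
    log≤ : ⌈log₂ (2 ℕ.* jointBound ws ⊔ J.scale) ⌉ ≤ suc S
    log≤ = n≤2^e⇒⌈log₂n⌉≤e (suc S) (ℕ.⊔-lub (ℕ.*-monoʳ-≤ 2 (jointBound≤2^∑ ws))
             (ℕ.≤-trans J.scale≤bound (ℕ.≤-trans (jointBound≤2^∑ ws) (ℕ.m≤n*m (2 ℕ.^ S) 2))))

  module _ d {a : Fin (suc d) → ℤ} (ws : ∀ j → Certificate (a j)) {x : ℤ}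
           (root : x ^ suc d + ∑[ s < suc d ] (a s * x ^ toℕ s) ≈ 0ℤ) where

    private
      module J = JointCertificate (jointCertificate (suc d) ws)
      D = jointDim ws

      companion-root : ∀ α → ∑[ s < suc d ] (x ^ toℕ s * (J.matrix s *ᵥ J.vector) α) ≈ - (+ J.scale * (x ^ suc d * J.vector α))
      companion-root α = begin
        ∑[ s < suc d ] (x ^ toℕ s * (J.matrix s *ᵥ J.vector) α)
          ≈⟨ ∑-cong (λ s → *-congˡ (x ^ toℕ s) (J.scales s α)) ⟩
        ∑[ s < suc d ] (x ^ toℕ s * ((+ J.scale * a s) * J.vector α))
          ≡⟨ sum-cong-≗ {suc d} (λ s → regroup (x ^ toℕ s) (+ J.scale) (a s) (J.vector α)) ⟩
        ∑[ s < suc d ] ((+ J.scale * J.vector α) * (a s * x ^ toℕ s))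
          ≡⟨ *-distribˡ-sum (+ J.scale * J.vector α) (λ s → a s * x ^ toℕ s) ⟨
        (+ J.scale * J.vector α) * ∑[ s < suc d ] (a s * x ^ toℕ s)
          ≈⟨ *-congˡ (+ J.scale * J.vector α) (≈-trans (≈-reflexive (isolate (x ^ suc d) _)) (+-cong root ≈-refl)) ⟩
        (+ J.scale * J.vector α) * (0ℤ - x ^ suc d)
          ≡⟨ finish (+ J.scale) (J.vector α) (x ^ suc d) ⟩
        - (+ J.scale * (x ^ suc d * J.vector α)) ∎
        where
        open ≈-Reasoning ≈-setoid
        regroup : ∀ y k a v → y * ((k * a) * v) ≡ (k * v) * (a * y)
        regroup = solve-∀
        isolate : ∀ y s → s ≡ (y + s) - y
        isolate = solve-∀
        finish : ∀ k v y → (k * v) * (0ℤ - y) ≡ - (k * (y * v))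
        finish = solve-∀

    rootCertificate : Certificate x
    rootCertificate = record
      { dim = suc d ℕ.* D ; matrix = companion d D J.matrix (+ J.scale)
      ; bound = jointBound ws ; bounded = companion-bounded d D J.matrix (+ J.scale) J.scale≤bound J.bounded
      ; scale = J.scale ; scale≉0 = J.scale≉0
      ; vector = companionVector d D x J.vector ; support = combine {suc d} {D} zero J.support
      ; support≉0 = J.support≉0 ∘ ≈-trans (≈-reflexive (sym (trans (companionVector-combine d D x J.vector zero J.support) (ℤ.*-identityˡ _))))
      ; scales = companion-scales d D J.matrix (+ J.scale) x J.vector companion-root }

    size-rootCertificate : size rootCertificate ≤ suc d ℕ.* ∏ (suc d) (λ j → size (ws j))
    size-rootCertificate = begin
      suc d ℕ.* D ℕ.+ ⌈log₂ (jointBound ws ⊔ J.scale) ⌉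
        ≤⟨ ℕ.+-monoʳ-≤ (suc d ℕ.* D) (n≤2^e⇒⌈log₂n⌉≤e S (ℕ.⊔-lub (jointBound≤2^∑ ws) (ℕ.≤-trans J.scale≤bound (jointBound≤2^∑ ws)))) ⟩
      suc d ℕ.* D ℕ.+ S
        ≤⟨ ℕ.+-monoʳ-≤ (suc d ℕ.* D) (ℕ.m≤n*m S (suc d)) ⟩
      suc d ℕ.* D ℕ.+ suc d ℕ.* S
        ≡⟨ ℕ.*-distribˡ-+ (suc d) D S ⟨
      suc d ℕ.* (D ℕ.+ S)
        ≤⟨ ℕ.*-monoʳ-≤ (suc d) (jointDim+∑≤∏size ws) ⟩
      suc d ℕ.* ∏ (suc d) (λ j → size (ws j)) ∎
      where
      open ℕ.≤-Reasoning
      S = ∑ (suc d) (logHeight ws)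

  det≈0 : ∀ {n} (A : Matrix n) (v : Vector ℤ n) {c} → (∀ r → (A *ᵥ v) r ≈ 0ℤ) → ¬ v c ≈ 0ℤ → det A ≈ 0ℤ
  det≈0 {suc n} A v {c} Av≈0 vc≉0 = Sum.[ ⊥-elim ∘ vc≉0 , (λ detA≈0 → detA≈0) ] (*≈0⇒≈0⊎≈0 (begin
    v c * det A
      ≡⟨ det-replaceColumn-*ᵥ A c v ⟨
    det (replaceColumn A c (A *ᵥ v))
      ≡⟨ det-replaceColumn A c (A *ᵥ v) ⟩
    sumMaps (suc n) (suc n) (λ σ → sign σ * ((A *ᵥ v) (σ c) * minorTerm A c σ))
      ≈⟨ sumMaps-cong-≈ (suc n) (suc n) (λ σ → *-congˡ (sign σ) (*-congʳ (minorTerm A c σ) (Av≈0 (σ c)))) ⟩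
    sumMaps (suc n) (suc n) (λ σ → sign σ * (0ℤ * minorTerm A c σ))
      ≡⟨ sumMaps-zero (suc n) (suc n) (λ σ → sign σ * (0ℤ * minorTerm A c σ)) (λ σ → trans (cong (sign σ *_) (ℤ.*-zeroˡ (minorTerm A c σ))) (ℤ.*-zeroʳ (sign σ))) ⟩
    0ℤ                                                                 ∎))
    where open ≈-Reasoning ≈-setoid

  charPoly-root : ∀ {n} (M : Matrix n) {λ′ v c} → Scales M λ′ v → ¬ v c ≈ 0ℤ → eval (suc n) (charPoly M) λ′ ≈ 0ℤ
  charPoly-root {n} M {λ′} {v} M-scales vc≉0 =
    ≈-trans (≈-reflexive (charPoly-eval M λ′)) (det≈0 (λ r i → - M r i + δ r i * λ′) v kernel vc≉0)
    where
    kernel : ∀ r → ((λ r i → - M r i + δ r i * λ′) *ᵥ v) r ≈ 0ℤ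
    kernel r = begin
      ∑[ c < n ] ((- M r c + δ r c * λ′) * v c)
        ≡⟨ sum-cong-≗ {n} (λ c → trans (expand (M r c) (δ r c) λ′ (v c)) (cong (λ t → - (M r c * v c) + t * (λ′ * v c)) (δ-sym r c))) ⟩
      ∑[ c < n ] (- (M r c * v c) + δ c r * (λ′ * v c))
        ≡⟨ ∑-distrib-+ (λ c → - (M r c * v c)) (λ c → δ c r * (λ′ * v c)) ⟩
      ∑[ c < n ] (- (M r c * v c)) + ∑[ c < n ] (δ c r * (λ′ * v c))
        ≡⟨ cong₂ _+_ (∑-neg (λ c → M r c * v c)) (∑-δ (λ c → λ′ * v c) r) ⟩
      - (M *ᵥ v) r + λ′ * v r
        ≈⟨ +-cong (-‿cong (M-scales r)) ≈-refl ⟩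
      - (λ′ * v r) + λ′ * v r
        ≡⟨ ℤ.+-inverseˡ (λ′ * v r) ⟩
      0ℤ ∎
      where
      open ≈-Reasoning ≈-setoid
      expand : ∀ m i x v → (- m + i * x) * v ≡ - (m * v) + i * (x * v)
      expand = solve-∀

  ^-*-inverse : ∀ {x y} → x * y ≈ 1ℤ → ∀ i → x ^ i * y ^ i ≈ 1ℤ
  ^-*-inverse xy≈1 zero    = ≈-refl
  ^-*-inverse {x} {y} xy≈1 (suc i) =
    ≈-trans (≈-reflexive (*-interchange x (x ^ i) y (y ^ i))) (≈-trans (*-cong xy≈1 (^-*-inverse xy≈1 i)) ≈-refl)

  reversedRoot : ∀ (c : ℕ → ℤ) {n j λ′ μ} → j ≤ n → (∀ i → i < j → c i ≈ 0ℤ) →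
                 eval (suc n) c λ′ ≈ 0ℤ → λ′ * μ ≈ 1ℤ → ∑ℕ (suc (n ℕ.∸ j)) (λ s → c (n ℕ.∸ s) * μ ^ s) ≈ 0ℤ
  reversedRoot c {n} {j} {λ′} {μ} j≤n c<j≈0 root λμ≈1 = begin
    ∑ℕ (suc e) g
      ≡⟨ ℤ.+-identityʳ _ ⟨
    ∑ℕ (suc e) g + 0ℤ
      ≈⟨ +-cong (≈-refl {∑ℕ (suc e) g}) (≈-sym tail≈0) ⟩
    ∑ℕ (suc e) g + ∑ℕ j (λ t → g (suc e ℕ.+ t))
      ≡⟨ ∑ℕ-+ (suc e) j g ⟨
    ∑ℕ (suc e ℕ.+ j) g
      ≡⟨ cong (λ m → ∑ℕ m g) (cong suc (ℕ.m∸n+n≡m j≤n)) ⟩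
    ∑ℕ (suc n) g
      ≡⟨ ∑ℕ-cong (suc n) (λ s s≤n → cong (λ t → c (n ℕ.∸ s) * μ ^ t) (sym (ℕ.m∸[m∸n]≡n (ℕ.≤-pred s≤n)))) ⟩
    ∑ℕ (suc n) (λ s → c (n ℕ.∸ s) * μ ^ (n ℕ.∸ (n ℕ.∸ s)))
      ≡⟨ ∑ℕ-reverse (suc n) (λ i → c i * μ ^ (n ℕ.∸ i)) ⟨
    ∑ℕ (suc n) (λ i → c i * μ ^ (n ℕ.∸ i))
      ≈⟨ ∑-cong (λ i → ≈-sym (scaled (toℕ i) (ℕ.≤-pred (Fin.toℕ<n i)))) ⟩
    ∑ℕ (suc n) (λ i → μ ^ n * (c i * λ′ ^ i))
      ≡⟨ *-distribˡ-sum {suc n} (μ ^ n) (λ i → c (toℕ i) * λ′ ^ toℕ i) ⟨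
    μ ^ n * eval (suc n) c λ′
      ≈⟨ *-congˡ (μ ^ n) root ⟩
    μ ^ n * 0ℤ
      ≡⟨ ℤ.*-zeroʳ (μ ^ n) ⟩
    0ℤ ∎
    where
    open ≈-Reasoning ≈-setoid
    e = n ℕ.∸ j
    g : ℕ → ℤ
    g s = c (n ℕ.∸ s) * μ ^ s
    scaled : ∀ i → i ≤ n → μ ^ n * (c i * λ′ ^ i) ≈ c i * μ ^ (n ℕ.∸ i)
    scaled i i≤n = begin
      μ ^ n * (c i * λ′ ^ i)                       ≡⟨ cong (λ m → μ ^ m * (c i * λ′ ^ i)) (ℕ.m+[n∸m]≡n i≤n) ⟨
      μ ^ (i ℕ.+ (n ℕ.∸ i)) * (c i * λ′ ^ i)       ≡⟨ cong (_* (c i * λ′ ^ i)) (ℤ.^-distribˡ-+-* μ i (n ℕ.∸ i)) ⟩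
      (μ ^ i * μ ^ (n ℕ.∸ i)) * (c i * λ′ ^ i)     ≡⟨ regroup (μ ^ i) (μ ^ (n ℕ.∸ i)) (c i) (λ′ ^ i) ⟩
      c i * (λ′ ^ i * μ ^ i) * μ ^ (n ℕ.∸ i)       ≈⟨ *-congʳ (μ ^ (n ℕ.∸ i)) (*-congˡ (c i) (^-*-inverse λμ≈1 i)) ⟩
      c i * 1ℤ * μ ^ (n ℕ.∸ i)                     ≡⟨ cong (_* μ ^ (n ℕ.∸ i)) (ℤ.*-identityʳ (c i)) ⟩
      c i * μ ^ (n ℕ.∸ i)                          ∎
      where
      regroup : ∀ a b c l → (a * b) * (c * l) ≡ c * (l * a) * b
      regroup = solve-∀
    tail≈0 : ∑ℕ j (λ t → g (suc e ℕ.+ t)) ≈ 0ℤ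
    tail≈0 = ≈-trans (∑-cong (λ t → *-congʳ (μ ^ (suc e ℕ.+ toℕ t)) (c<j≈0 _ (below (toℕ t) (Fin.toℕ<n t)))))
                     (≈-reflexive (∑-zero {j} (λ t → 0ℤ * μ ^ (suc e ℕ.+ toℕ t)) (λ t → ℤ.*-zeroˡ (μ ^ (suc e ℕ.+ toℕ t)))))
      where
      below : ∀ t → t < j → n ℕ.∸ (suc e ℕ.+ t) < j
      below t t<j = subst (_< j) (sym gap) (ℕ.∸-monoʳ-< {j} {suc t} {0} (s≤s z≤n) t<j)
        where
        gap : n ℕ.∸ (suc e ℕ.+ t) ≡ j ℕ.∸ suc t
        gap = trans (cong₂ ℕ._∸_ (sym (ℕ.m∸n+n≡m j≤n)) (sym (ℕ.+-suc e t))) (ℕ.[m+n]∸[m+o]≡n∸o e j (suc t))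

  certificateOfScaled : ∀ {x n m} (M : Matrix n) → Bounded m M → (v : Vector ℤ n) {c : Fin n} → ¬ v c ≈ 0ℤ →
                        ∀ w → ¬ w ≈ 0ℤ → Scales M (w * x) v → Σ (Certificate x) λ cert → size cert ≡ n ℕ.+ ⌈log₂ (m ⊔ ∣ w ∣) ⌉
  certificateOfScaled {n = n} {m} M M≤m v {c} vc≉0 (+ k) w≉0 M-scales =
    record { dim = n ; matrix = M ; bound = m ; bounded = M≤m ; scale = k ; scale≉0 = w≉0
           ; vector = v ; support = c ; support≉0 = vc≉0 ; scales = M-scales } , refl
  certificateOfScaled {x} {n} {m} M M≤m v {c} vc≉0 -[1+ k ] w≉0 M-scales =
    record { dim = n ; matrix = negate M ; bound = m ; bounded = negate-bounded {A = M} M≤m ; scale = suc k ; scale≉0 = w≉0 ∘ -‿cong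
           ; vector = v ; support = c ; support≉0 = vc≉0
           ; scales = λ r → ≈-trans (≈-reflexive (negate-*ᵥ M v r)) (≈-trans (-‿cong (M-scales r)) (≈-reflexive (move-sign -[1+ k ] x (v r)))) } , refl
    where
    move-sign : ∀ w x v → - ((w * x) * v) ≡ ((- w) * x) * v
    move-sign = solve-∀


  scaledRootCertificate : ∀ e (q : Fin (suc e) → ℤ) {w μ y H} k → ¬ w ≈ 0ℤ → ∣ w ∣ ≤ H → (∀ s → ∣ q s ∣ ≤ H) →
                          ∑[ s < suc e ] (q s * μ ^ toℕ s) ≈ - (w * μ ^ suc e) → + k * μ ≈ y →
                          Σ (Certificate y) λ cert → size cert ≡ suc e ℕ.* 1 ℕ.+ ⌈log₂ (k ℕ.* H ⊔ ∣ w ∣) ⌉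
  scaledRootCertificate e q {w} {μ} {y} {H} k w≉0 w≤H q≤H root kμ≈y =
    certificateOfScaled kC kC-bounded cv {combine {suc e} {1} zero zero} cv≉0 w w≉0 kC-scales
    where
    N = suc e ℕ.* 1
    coefficient : Fin (suc e) → Matrix 1
    coefficient s _ _ = q s
    one : Vector ℤ 1
    one _ = 1ℤ
    C = companion e 1 coefficient w
    cv = companionVector e 1 μ one
    C-scales : Scales C (w * μ) cv
    C-scales = companion-scales e 1 coefficient w μ one (λ α → ≈-trans
      (≈-reflexive (sum-cong-≗ {suc e} (λ s → simplify (μ ^ toℕ s) (q s))))
      (≈-trans root (≈-reflexive (cong (λ t → - (w * t)) (sym (ℤ.*-identityʳ (μ ^ suc e)))))))
      where
      simplify : ∀ y c → y * (c * 1ℤ + 0ℤ) ≡ c * y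
      simplify = solve-∀
    kC : Matrix N
    kC X Y = + k * C X Y
    kC-bounded : Bounded (k ℕ.* H) kC
    kC-bounded X Y = ℕ.≤-trans (ℕ.≤-reflexive (ℤ.abs-* (+ k) (C X Y))) (ℕ.*-monoʳ-≤ k (companion-bounded e 1 coefficient w w≤H (λ s _ _ → q≤H s) X Y))
    kC-scales : Scales kC (w * y) cv
    kC-scales X = begin
      (kC *ᵥ cv) X                          ≡⟨ sum-cong-≗ {N} (λ Y → ℤ.*-assoc (+ k) (C X Y) (cv Y)) ⟩
      ∑[ Y < N ] (+ k * (C X Y * cv Y))     ≡⟨ *-distribˡ-sum {N} (+ k) (λ Y → C X Y * cv Y) ⟨
      + k * (C *ᵥ cv) X                     ≈⟨ *-congˡ (+ k) (C-scales X) ⟩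
      + k * ((w * μ) * cv X)                ≡⟨ regroup (+ k) w μ (cv X) ⟩
      (w * (+ k * μ)) * cv X                ≈⟨ *-congʳ (cv X) (*-congˡ w kμ≈y) ⟩
      (w * y) * cv X                        ∎
      where
      open ≈-Reasoning ≈-setoid
      regroup : ∀ k c μ v → k * ((c * μ) * v) ≡ (c * (k * μ)) * v
      regroup = solve-∀
    cv≉0 : ¬ cv (combine {suc e} {1} zero zero) ≈ 0ℤ
    cv≉0 = 1≉0 ∘ ≈-trans (≈-reflexive (sym (trans (companionVector-combine e 1 μ one zero zero) (ℤ.*-identityˡ 1ℤ))))

  module _ {a b} (wa : Certificate a) (ab≈1 : a * b ≈ 1ℤ) where

    private
      open Certificate wa hiding (size)
      n : ℕ
      n = dim
      λ′ : ℤ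
      λ′ = + scale * a
      c : ℕ → ℤ
      c = charPoly matrix

      λ′≉0 : ¬ λ′ ≈ 0ℤ
      λ′≉0 λ′≈0 = Sum.[ scale≉0 , (λ a≈0 → 1≉0 (≈-trans (≈-sym ab≈1) (≈-trans (*-congʳ b a≈0) (≈-reflexive (ℤ.*-zeroˡ b))))) ]
                    (*≈0⇒≈0⊎≈0 λ′≈0)

      μ : ℤ
      μ = Σ.proj₁ (inverse λ′ λ′≉0)
      λ′μ≈1 : λ′ * μ ≈ 1ℤ
      λ′μ≈1 = Σ.proj₂ (inverse λ′ λ′≉0)

      kμ≈b : + scale * μ ≈ b
      kμ≈b = begin
        + scale * μ              ≡⟨ ℤ.*-identityʳ _ ⟨
        (+ scale * μ) * 1ℤ       ≈⟨ *-congˡ (+ scale * μ) (≈-sym ab≈1) ⟩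
        (+ scale * μ) * (a * b)  ≡⟨ regroup (+ scale) μ a b ⟩
        (λ′ * μ) * b             ≈⟨ *-congʳ b λ′μ≈1 ⟩
        1ℤ * b                   ≡⟨ ℤ.*-identityˡ b ⟩
        b                        ∎
        where
        open ≈-Reasoning ≈-setoid
        regroup : ∀ k μ a b → (k * μ) * (a * b) ≡ ((k * a) * μ) * b
        regroup = solve-∀

      lowest : Σ ℕ λ j → j ≤ n × ¬ c j ≈ 0ℤ × (∀ i → i < j → c i ≈ 0ℤ)
      lowest = leastNonzero c n (λ cn≈0 → 1≉0 (≈-trans (≈-reflexive (sym (charPoly-monic matrix))) cn≈0))
      j : ℕ
      j = Σ.proj₁ lowest
      j≤n : j ≤ n
      j≤n = Σ.proj₁ (Σ.proj₂ lowest)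
      cj≉0 : ¬ c j ≈ 0ℤ
      cj≉0 = Σ.proj₁ (Σ.proj₂ (Σ.proj₂ lowest))

      g : ℕ → ℤ
      g s = c (n ℕ.∸ s) * μ ^ s

      -- μ is a root of the reversed polynomial Σ_{s ≤ n ∸ j} c (n ∸ s) X^s, whose leading coefficient is c j;
      -- its degree n ∸ j is positive because a constant ≉ 0 has no root.
      reversed : Σ ℕ λ e → suc e ≤ n × ∑ℕ (suc e) g ≈ - (c j * μ ^ suc e)
      reversed = split (n ℕ.∸ j) refl (reversedRoot c {λ′ = λ′} {μ} j≤n (Σ.proj₂ (Σ.proj₂ (Σ.proj₂ lowest))) (charPoly-root matrix {λ′} scales support≉0) λ′μ≈1)
        where
        split : ∀ e → e ≡ n ℕ.∸ j → ∑ℕ (suc e) g ≈ 0ℤ → Σ ℕ λ e′ → suc e′ ≤ n × ∑ℕ (suc e′) g ≈ - (c j * μ ^ suc e′)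
        split zero    e≡ g≈0 = ⊥-elim (cj≉0 (≈-trans (≈-reflexive (trans (cong c (trans (sym (ℕ.m∸[m∸n]≡n j≤n)) (cong (n ℕ.∸_) (sym e≡))))
                                                                            (trans (sym (ℤ.*-identityʳ _)) (sym (ℤ.+-identityʳ _))))) g≈0))
        split (suc e) e≡ g≈0 = e , subst (_≤ n) (sym e≡) (ℕ.m∸n≤m n j) , (begin
          ∑ℕ (suc e) g                              ≡⟨ isolate (∑ℕ (suc e) g) (g (suc e)) ⟩
          (∑ℕ (suc e) g + g (suc e)) - g (suc e)    ≡⟨ cong₂ (λ t u → t - c u * μ ^ suc e) (sym (∑ℕ-suc (suc e) g)) (trans (cong (n ℕ.∸_) e≡) (ℕ.m∸[m∸n]≡n j≤n)) ⟩
          ∑ℕ (suc (suc e)) g - c j * μ ^ suc e      ≈⟨ +-cong g≈0 ≈-refl ⟩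
          0ℤ - c j * μ ^ suc e                      ≡⟨ ℤ.+-identityˡ _ ⟩
          - (c j * μ ^ suc e)                       ∎)
          where
          open ≈-Reasoning ≈-setoid
          isolate : ∀ s t → s ≡ (s + t) - t
          isolate = solve-∀

      B : ℕ
      B = bound ⊔ 1
      H : ℕ
      H = n ℕ.^ n ℕ.* (2 ℕ.^ n ℕ.* B ℕ.^ n)

      c≤H : ∀ i → ∣ c i ∣ ≤ H
      c≤H = ∣charPoly∣≤ matrix (ℕ.m≤n⊔m bound 1) (λ r s → ℕ.≤-trans (bounded r s) (ℕ.m≤m⊔n bound 1))

      e : ℕ
      e = Σ.proj₁ reversed

      certified : Σ (Certificate b) λ cert → size cert ≡ suc e ℕ.* 1 ℕ.+ ⌈log₂ (scale ℕ.* H ⊔ ∣ c j ∣) ⌉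
      certified = scaledRootCertificate e (λ s → c (n ℕ.∸ toℕ s)) scale cj≉0 (c≤H j) (λ s → c≤H (n ℕ.∸ toℕ s))
                                        (Σ.proj₂ (Σ.proj₂ reversed)) kμ≈b

    inverseCertificate : Certificate b
    inverseCertificate = Σ.proj₁ certified

    size-inverseCertificate : size inverseCertificate ≤ 2 ℕ.* (size wa ℕ.* size wa) ℕ.+ size wa
    size-inverseCertificate = begin
      size inverseCertificate                             ≡⟨ Σ.proj₂ certified ⟩
      suc e ℕ.* 1 ℕ.+ ⌈log₂ (scale ℕ.* H ⊔ ∣ c j ∣) ⌉     ≤⟨ ℕ.+-mono-≤ (ℕ.≤-trans (ℕ.≤-reflexive (ℕ.*-identityʳ (suc e))) (Σ.proj₁ (Σ.proj₂ reversed)))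
                                                                       (n≤2^e⇒⌈log₂n⌉≤e (L ℕ.+ E) (ℕ.⊔-lub kH≤ cj≤)) ⟩
      n ℕ.+ (L ℕ.+ E)                                     ≤⟨ quadratic-size-bound n L 1≤dim ⟩
      2 ℕ.* ((n ℕ.+ L) ℕ.* (n ℕ.+ L)) ℕ.+ (n ℕ.+ L)       ∎
      where
      open ℕ.≤-Reasoning
      L = ⌈log₂ (bound ⊔ scale) ⌉
      E = n ℕ.* n ℕ.+ (n ℕ.+ L ℕ.* n)
      H≤2^E : H ≤ 2 ℕ.^ E
      H≤2^E = ℕ.≤-trans (ℕ.*-mono-≤ (ℕ.≤-trans (ℕ.^-monoˡ-≤ n (n≤2^n n)) (ℕ.≤-reflexive (ℕ.^-*-assoc 2 n n)))
                                     (ℕ.*-monoʳ-≤ (2 ℕ.^ n) (ℕ.≤-trans (ℕ.^-monoˡ-≤ n B≤2^L) (ℕ.≤-reflexive (ℕ.^-*-assoc 2 L n)))))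
                        (ℕ.≤-reflexive (trans (cong (2 ℕ.^ (n ℕ.* n) ℕ.*_) (sym (ℕ.^-distribˡ-+-* 2 n (L ℕ.* n))))
                                              (sym (ℕ.^-distribˡ-+-* 2 (n ℕ.* n) (n ℕ.+ L ℕ.* n)))))
        where
        B≤2^L : B ≤ 2 ℕ.^ L
        B≤2^L = ℕ.⊔-lub (Σ.proj₁ (⊔≤2^⌈log₂⊔⌉ bound scale)) (ℕ.m^n>0 2 L)
      kH≤ : scale ℕ.* H ≤ 2 ℕ.^ (L ℕ.+ E)
      kH≤ = ℕ.≤-trans (ℕ.*-mono-≤ (Σ.proj₂ (⊔≤2^⌈log₂⊔⌉ bound scale)) H≤2^E) (ℕ.≤-reflexive (sym (ℕ.^-distribˡ-+-* 2 L E)))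
      cj≤ : ∣ c j ∣ ≤ 2 ℕ.^ (L ℕ.+ E)
      cj≤ = ℕ.≤-trans (c≤H j) (ℕ.≤-trans H≤2^E (ℕ.^-monoʳ-≤ 2 (ℕ.m≤n+m E L)))

  private
    fromIsF : ∀ {x c} → IsF p x c → Σ (Certificate (+ x)) (λ w → size w ≡ c)
    fromIsF = certificate ∘ Σ.proj₁

    +-mod≈ : ∀ a b → + a + + b ≈ + addF p a b
    +-mod≈ a b = ≈-trans (≈-reflexive (sym (ℤ.pos-+ a b))) (≈-sym (+mod≈ (a ℕ.+ b)))

    *-mod≈ : ∀ a b → + a * + b ≈ + mulF p a b
    *-mod≈ a b = ≈-trans (≈-reflexive (sym (ℤ.pos-* a b))) (≈-sym (+mod≈ (a ℕ.* b)))

    neg-mod≈ : ∀ {a} → a < p → - + a ≈ + negF p a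
    neg-mod≈ {a} a<p = ≈-trans (by (- 1ℤ) (add-p (+ a) (+ p)))
                               (≈-trans (≈-reflexive (trans (ℤ.m-n≡m⊖n p a) (ℤ.⊖-≥ (ℕ.<⇒≤ a<p)))) (≈-sym (+mod≈ (p ℕ.∸ a))))
      where
      add-p : ∀ a p → - a ≡ (p - a) + - 1ℤ * p
      add-p = solve-∀

    evalMonic≈ : ∀ {d} (a : Fin (suc d) → ℕ) x → evalMonic p (suc d) a x ≡ 0 →
                 (+ x) ^ suc d + ∑[ s < suc d ] (+ a s * (+ x) ^ toℕ s) ≈ 0ℤ
    evalMonic≈ {d} a x P≡0 = ≈-trans (≈-reflexive (sym lift)) (≈-trans (≈-sym (+mod≈ _)) (≈-reflexive (cong +_ P≡0)))
      where
      lift : + (x ℕ.^ suc d ℕ.+ ∑ (suc d) (λ j → a j ℕ.* x ℕ.^ toℕ j)) ≡ (+ x) ^ suc d + ∑[ s < suc d ] (+ a s * (+ x) ^ toℕ s)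
      lift = trans (ℤ.pos-+ (x ℕ.^ suc d) _) (cong₂ _+_ (+^ x (suc d))
               (trans (+∑ (suc d) (λ j → a j ℕ.* x ℕ.^ toℕ j)) (sum-cong-≗ {suc d} (λ j → trans (ℤ.pos-* (a j) _) (cong (_*_ (+ a j)) (+^ x (toℕ j)))))))

  add-bound : ∀ {a b fa fb fs} → IsF p a fa → IsF p b fb → IsF p (addF p a b) fs → fs ≤ fa ℕ.* fb ℕ.+ 1
  add-bound {a} {b} isa isb iss with fromIsF isa | fromIsF isb
  ... | wa , refl | wb , refl = ℕ.≤-trans (minimal iss (addCertificate wa wb) (+-mod≈ a b)) (size-addCertificate wa wb)

  mul-bound : ∀ {a b fa fb fm} → IsF p a fa → IsF p b fb → IsF p (mulF p a b) fm → fm ≤ fa ℕ.* fb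
  mul-bound {a} {b} isa isb ism with fromIsF isa | fromIsF isb
  ... | wa , refl | wb , refl = ℕ.≤-trans (minimal ism (multiplyCertificate wa wb) (*-mod≈ a b)) (size-multiplyCertificate wa wb)

  neg-eq : ∀ {a fa fn} → a < p → IsF p a fa → IsF p (negF p a) fn → fn ≡ fa
  neg-eq {a} a<p isa isn with fromIsF isa | fromIsF isn
  ... | wa , refl | wn , refl = ℕ.≤-antisym (minimal isn (negateCertificate wa) (neg-mod≈ a<p))
                                            (minimal isa (negateCertificate wn) (≈-trans (-‿cong (≈-sym (neg-mod≈ a<p))) (≈-reflexive (ℤ.neg-involutive (+ a)))))

  inv-bound : ∀ {a b fa fb} → mulF p a b ≡ 1 → IsF p a fa → IsF p b fb → fb ≤ 2 ℕ.* (fa ℕ.* fa) ℕ.+ fa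
  inv-bound {a} {b} ab≡1 isa isb with fromIsF isa
  ... | wa , refl = ℕ.≤-trans (minimal isb (inverseCertificate wa ab≈1) ≈-refl) (size-inverseCertificate wa ab≈1)
    where
    ab≈1 : + a * + b ≈ 1ℤ
    ab≈1 = ≈-trans (*-mod≈ a b) (≈-reflexive (cong +_ ab≡1))

  root-bound : ∀ {n} {a fa : Fin n → ℕ} {x fx} → 1 ≤ n → (∀ j → IsF p (a j) (fa j)) →
               evalMonic p n a x ≡ 0 → IsF p x fx → fx ≤ n ℕ.* ∏ n fa
  root-bound {suc d} {a} {fa} {x} _ isa P≡0 isx =
    ℕ.≤-trans (minimal isx (rootCertificate d ws (evalMonic≈ a x P≡0)) ≈-refl)
              (ℕ.≤-trans (size-rootCertificate d ws {+ x} (evalMonic≈ a x P≡0)) (ℕ.≤-reflexive (cong (suc d ℕ.*_) (∏-cong (suc d) (Σ.proj₂ ∘ fromIsF ∘ isa)))))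
    where
    ws : ∀ j → Certificate (+ a j)
    ws = Σ.proj₁ ∘ fromIsF ∘ isa

proposition1p6 : (I : Set) (U : Ultrafilter I) (p : I → ℕ) →
    Ultrapower.NonstandardPrime U p →
    Ultrapower.AddBound U p × Ultrapower.MulBound U p × Ultrapower.NegEq U p ×
    Ultrapower.InvBound U p × Ultrapower.RootBound U p
proposition1p6 I U p (prime , _) = add , mul , neg , inv , root
  where
  open Ultrafilter U using (upward; inter)
  open Ultrafilter U using (_∈𝓕)
  infixr 5 _∧_
  _∧_ : ∀ {A B : I → Set} → A ∈𝓕 → B ∈𝓕 → (λ i → A i × B i) ∈𝓕
  _∧_ = inter
  open PrimeField
  add : Ultrapower.AddBound U p
  add _ _ _ _ _ _ _ isa isb iss = upward (λ i (pᵢ , isaᵢ , isbᵢ , issᵢ) → add-bound pᵢ isaᵢ isbᵢ issᵢ) (prime ∧ isa ∧ isb ∧ iss)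
  mul : Ultrapower.MulBound U p
  mul _ _ _ _ _ _ _ isa isb ism = upward (λ i (pᵢ , isaᵢ , isbᵢ , ismᵢ) → mul-bound pᵢ isaᵢ isbᵢ ismᵢ) (prime ∧ isa ∧ isb ∧ ism)
  neg : Ultrapower.NegEq U p
  neg _ _ _ a<p isa isn = upward (λ i (pᵢ , a<pᵢ , isaᵢ , isnᵢ) → neg-eq pᵢ a<pᵢ isaᵢ isnᵢ) (prime ∧ a<p ∧ isa ∧ isn)
  inv : Ultrapower.InvBound U p
  inv _ _ _ _ _ _ _ ab≡1 isa isb = upward (λ i (pᵢ , ab≡1ᵢ , isaᵢ , isbᵢ) → inv-bound pᵢ ab≡1ᵢ isaᵢ isbᵢ) (prime ∧ ab≡1 ∧ isa ∧ isb)
  root : Ultrapower.RootBound U p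
  root _ _ _ _ _ 1≤n _ isa _ P≡0 isx =
    upward (λ i (pᵢ , 1≤nᵢ , isaᵢ , P≡0ᵢ , isxᵢ) → root-bound pᵢ 1≤nᵢ isaᵢ P≡0ᵢ isxᵢ) (prime ∧ 1≤n ∧ isa ∧ P≡0 ∧ isx)
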